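{- Let $(Q,Q')$ be a completely extended linear quiver with $n=|Q_0|\ge2$. Let $\mathcal{G}$ be the set of GCCs and $\mathcal{P}$ the set of $T$-paths from $\mathfrak{v}$ to $\mathfrak{w}$. For a GCC $\{S_{i,r}\}$, form the edge sequence $\alpha'=(\alpha'_1,\dots,\alpha'_{2n+1})$ as follows: - $\alpha'_{2i}=T_i$ for $i\in[1,n]$; - for $i\in[1,n-1]$, $\alpha'_{2i+1}=T_i$ if $(|S_{i,1}|,|S_{i,2}|)=(\delta_i,1-\delta_i)$, $T_{i+1}$ if it equals $(1-\delta_i,\delta_i)$, and $T_{i,i+1}$ if it equals $(0,0)$; - $\alpha'_1=T_{1,0}$ if $|S_{1,1+\delta_1}|=1-\delta_1$ and $T_{1,1}$ otherwise; - $\alpha'_{2n+1}=T_{n,0}$ if $|S_{n-1,2-\delta_{n-1}}|=\delta_{n-1}$ and $T_{n,1}$ otherwise. Let $\psi_{\mathcal{G},\mathcal{P}}(\{S_{i,r}\})$ be the path obtained from $\alpha'$, viewed as a path from $\mathfrak{v}$ to $\mathfrak{w}$, by cancelling duplicate pairs, i.e. deleting pairs of consecutive identical edges. Then $\psi_{\mathcal{G},\mathcal{P}}$ is a well-defined bijection $\mathcal{G}\to\mathcal{P}$. Moreover, for $\alpha=\psi_{\mathcal{G},\mathcal{P}}(\{S_{i,r}\})$, $$\prod_{i=1}^n x_i^{ -1}\prod_{i=0}^n y_i=x(\alpha).$$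
   Context: A linear quiver $Q$ has vertices $1,\dots,n$ with exactly one arrow between $i$ and $i+1$ for each $i\in[1,n-1]$, and no other arrows. Set $\delta_i=0$ if the arrow is $i\to i+1$ and $\delta_i=1$ otherwise. The completely extended linear quiver $Q'$ adds: - a vertex $(i,i+1)$ forming an oriented $3$-cycle with $i,i+1$, for each $i\in[1,n-1]$; - vertices $(1,0),(1,1)$ with $1\to(1,0)\to(1,1)\to1$; - vertices $(n,0),(n,1)$ with $n\to(n,0)\to(n,1)\to n$. Formal variables $x_e$ are attached to the vertices $e$ of $Q'$ (written $x_i$, $x_{i,i+1}$, $x_{1,0}$, etc.). GCC: for $i\in[1,n-1]$, let $S_{i,1}\subseteq\{u^{(i)}\}$ and $S_{i,2}\subseteq\{v^{(i)}\}$, each a subset of a one-element set. The collection is a GCC if $(|S_{i,1}|,|S_{i,2}|)\ne(1,1)$ for all $i$, and for $i\in[2,n-1]$: - if $(\delta_{i-1},\delta_i)=(0,0)$ then $|S_{i-1,2}|\ne|S_{i,1}|$; - if $(1,1)$ then $|S_{i-1,1}|\ne|S_{i,2}|$; - if $(0,1)$ then $|S_{i-1,2}|=|S_{i,2}|$; - if $(1,0)$ then $|S_{i-1,1}|=|S_{i,1}|$. For a GCC, set $y_i=x_{i+\delta_i}^{|S_{i,2}|}x_{i+1-\delta_i}^{|S_{i,1}|}x_{i,i+1}^{1-|S_{i,1}|-|S_{i,2}|}$ for $i\in[1,n-1]$. Set $y_0=x_{1,0}$ if $|S_{1,1+\delta_1}|=1-\delta_1$, else $x_{1,1}$. Set $y_n=x_{n,0}$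 if $|S_{n-1,2-\delta_{n-1}}|=\delta_{n-1}$, else $x_{n,1}$. Triangulation: let $\Pi$ be a convex polygon with $n+3$ vertices with a triangulation. Its $n$ diagonals are labelled $T_1,\dots,T_n$ and its $n+3$ boundary edges are labelled $T_{1,0},T_{1,1},T_{n,0},T_{n,1},T_{i,i+1}$ ($i\in[1,n-1]$). The labelling is such that for edges $T_e,T_f$, $Q'$ has an arrow $e\to f$ iff $T_e,T_f$ are two sides of a common triangle and $T_f$ is obtained from $T_e$ by counterclockwise rotation (less than $180^\circ$) about their common endpoint. Let $\mathfrak{v}$ be the common endpoint of $T_{1,0},T_{1,1}$ and $\mathfrak{w}$ the common endpoint of $T_{n,0},T_{n,1}$. The diagonal $M_{\mathfrak{v},\mathfrak{w}}$ crosses $T_1,\dots,T_n$; let $p_i=M_{\mathfrak{v},\mathfrak{w}}\cap T_i$. A $T$-path from $\mathfrak{v}$ to $\mathfrak{w}$ is a sequence $w_0\xrightarrow{T_{e_1}}w_1\xrightarrow{T_{e_2}}\cdots\xrightarrow{T_{e_l}}w_l$ satisfying: 1. $w_0=\mathfrak{v}$, $w_l=\mathfrak{w}$, and all $w_k$ are polygon vertices; 2. $T_{e_k}$ is an edge of the triangulation joining $w_{k-1}$ and $w_k$; 3. the $e_k$ are pairwise distinct; 4. $l$ is odd; 5. $T_{e_k}$ crosses $M_{\mathfrak{v},\mathfrak{w}}$ whenever $k$ is even; 6. if $j<k$ and both $T_{e_j},T_{e_k}$ cross $M_{\mathfrak{v},\mathfrak{w}}$, then $p_{e_j}$ is closer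 to $\mathfrak{v}$ than $p_{e_k}$. Set $x(\alpha)=\prod_{k\text{ odd}}x_{e_k}\prod_{k\text{ even}}x_{e_k}^{ -1}$. -}

module Defs where

open import Data.Nat using (ℕ; zero; suc; _+_; _∸_; _<_)
open import Data.Integer using (ℤ; +_; -_) renaming (_+_ to _+ℤ_; _*_ to _*ℤ_)
open import Data.Bool using (Bool; true; false; if_then_else_)
open import Data.Fin using (Fin; zero; suc; toℕ; inject₁; fromℕ)
open import Data.Fin.Subset using (Subset; ∣_∣)
open import Data.List using (List; []; _∷_; _++_; length; map; concatMap; lookup; allFin; foldr)
open import Data.List.Relation.Unary.Unique.Propositional using (Unique)
open import Data.Product using (Σ; _×_; _,_; proj₁; proj₂)
open import Data.Sum using (_⊎_)
open import Data.Unit using (⊤)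
open import Data.Empty using (⊥)
open import Relation.Nullary using (¬_; Dec; yes; no)
open import Relation.Nullary.Decidable using (⌊_⌋; _×-dec_)
open import Relation.Binary.PropositionalEquality using (_≡_; _≢_; refl; cong)
import Data.Nat as N
import Data.Integer
import Data.Fin as F

-- We write n = m + 2 (so n ≥ 2 is built in).
--   * diagonals T_1 … T_n           are  diag j,  j : Fin (2+m), T_{toℕ j + 1}
--   * arrows of Q, i ∈ [1,n-1]      are indexed by i : Fin (1+m), paper index toℕ i + 1;
--     arrow i lies between diagonals  inject₁ i  and  suc i
--   * δ i = false  means δ = 0 (arrow i → i+1),  δ i = true  means δ = 1.
--   * boundary edges  T_{i,i+1} = bnd i,  T_{1,0} = v0, T_{1,1} = v1,
--     T_{n,0} = w0, T_{n,1} = w1.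
-- The vertices e of Q' are identified with the edges T_e, so formal
-- variables x_e are indexed by Edge m.

data Edge (m : ℕ) : Set where
  diag : Fin (suc (suc m)) → Edge m
  bnd  : Fin (suc m) → Edge m
  v0 v1 w0 w1 : Edge m

-- polygon vertices: 𝔳, 𝔴, and the vertices to the left / right of M_{𝔳,𝔴}
data Vert : Set where
  𝔳 𝔴 : Vert
  L R : ℕ → Vert

_≟E_ : ∀ {m} (e f : Edge m) → Dec (e ≡ f)
diag a ≟E diag b with a F.≟ b
... | yes refl = yes refl
... | no ne = no λ { refl → ne refl }
bnd a ≟E bnd b with a F.≟ b
... | yes refl = yes refl
... | no ne = no λ { refl → ne refl }
v0 ≟E v0 = yes refl
v1 ≟E v1 = yes refl
w0 ≟E w0 = yes refl
w1 ≟E w1 = yes refl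
diag _ ≟E bnd _ = no λ ()
diag _ ≟E v0 = no λ ()
diag _ ≟E v1 = no λ ()
diag _ ≟E w0 = no λ ()
diag _ ≟E w1 = no λ ()
bnd _ ≟E diag _ = no λ ()
bnd _ ≟E v0 = no λ ()
bnd _ ≟E v1 = no λ ()
bnd _ ≟E w0 = no λ ()
bnd _ ≟E w1 = no λ ()
v0 ≟E diag _ = no λ ()
v0 ≟E bnd _ = no λ ()
v0 ≟E v1 = no λ ()
v0 ≟E w0 = no λ ()
v0 ≟E w1 = no λ ()
v1 ≟E diag _ = no λ ()
v1 ≟E bnd _ = no λ ()
v1 ≟E v0 = no λ ()
v1 ≟E w0 = no λ ()
v1 ≟E w1 = no λ ()
w0 ≟E diag _ = no λ ()
w0 ≟E bnd _ = no λ ()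
w0 ≟E v0 = no λ ()
w0 ≟E v1 = no λ ()
w0 ≟E w1 = no λ ()
w1 ≟E diag _ = no λ ()
w1 ≟E bnd _ = no λ ()
w1 ≟E v0 = no λ ()
w1 ≟E v1 = no λ ()
w1 ≟E w0 = no λ ()

_≟V_ : (a b : Vert) → Dec (a ≡ b)
𝔳 ≟V 𝔳 = yes refl
𝔴 ≟V 𝔴 = yes refl
L a ≟V L b with a N.≟ b
... | yes refl = yes refl
... | no ne = no λ { refl → ne refl }
R a ≟V R b with a N.≟ b
... | yes refl = yes refl
... | no ne = no λ { refl → ne refl }
𝔳 ≟V 𝔴 = no λ ()
𝔳 ≟V L _ = no λ ()
𝔳 ≟V R _ = no λ ()
𝔴 ≟V 𝔳 = no λ ()
𝔴 ≟V L _ = no λ ()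
𝔴 ≟V R _ = no λ ()
L _ ≟V 𝔳 = no λ ()
L _ ≟V 𝔴 = no λ ()
L _ ≟V R _ = no λ ()
R _ ≟V 𝔳 = no λ ()
R _ ≟V 𝔴 = no λ ()
R _ ≟V L _ = no λ ()

-- Going up along M_{𝔳,𝔴} from 𝔳 to 𝔴, the diagonal T_1 joins L 0 and R 0;
-- passing arrow i (between T_i and T_{i+1}), if δ_i = 0 the new diagonal
-- keeps its left endpoint and gets a new right endpoint, and if δ_i = 1 it
-- keeps its right endpoint and gets a new left endpoint.  The polygon is
-- 𝔳, R 0, R 1, …, R b, 𝔴, L a, …, L 0 in counterclockwise order.

count< : ∀ {k} → (Fin k → Bool) → Bool → ℕ → ℕ
count< {zero}  δ b j       = 0
count< {suc k} δ b zero    = 0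
count< {suc k} δ b (suc j) =
  (if ⌊ Data.Bool._≟_ (δ zero) b ⌋ then 1 else 0) + count< (λ i → δ (suc i)) b j

ends : ∀ {m} → (Fin (suc m) → Bool) → Edge m → Vert × Vert
ends δ (diag j) = L (count< δ true (toℕ j)) , R (count< δ false (toℕ j))
ends δ (bnd i) with δ i
... | false = R (count< δ false (toℕ i)) , R (suc (count< δ false (toℕ i)))
... | true  = L (count< δ true (toℕ i)) , L (suc (count< δ true (toℕ i)))
ends δ v0 = 𝔳 , R 0
ends δ v1 = 𝔳 , L 0
ends {m} δ w0 = 𝔴 , L (count< δ true (suc m))
ends {m} δ w1 = 𝔴 , R (count< δ false (suc m))

Joins : ∀ {m} → (Fin (suc m) → Bool) → Edge m → Vert → Vert → Set
Joins δ e a b = (ends δ e ≡ (a , b)) ⊎ (ends δ e ≡ (b , a))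

-- T-paths from 𝔳 to 𝔴.  A path w₀ -T_{e₁}→ w₁ … -T_{e_l}→ w_l with w₀ = 𝔳
-- is the list of its steps (e_k , w_k).

Path : ℕ → Set
Path m = List (Edge m × Vert)

ChainFrom : ∀ {m} → (Fin (suc m) → Bool) → Vert → Path m → Set
ChainFrom δ u [] = ⊤
ChainFrom δ u ((e , u') ∷ ps) = Joins δ e u u' × ChainFrom δ u' ps

endVert : ∀ {m} → Vert → Path m → Vert
endVert u [] = u
endVert u ((_ , u') ∷ ps) = endVert u' ps

Odd : ℕ → Set
Odd l = Σ ℕ λ t → l ≡ suc (t + t)

Even : ℕ → Set
Even l = Σ ℕ λ t → l ≡ t + t

-- T_e crosses M_{𝔳,𝔴} iff it is one of T_1 … T_n; p_{T_j} is closer to 𝔳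
-- than p_{T_{j'}} iff j < j'.
Crosses : ∀ {m} → Edge m → Set
Crosses {m} e = Σ (Fin (suc (suc m))) λ j → e ≡ diag j

edgeAt : ∀ {m} (ps : Path m) → Fin (length ps) → Edge m
edgeAt ps k = proj₁ (lookup ps k)

record IsTPath {m} (δ : Fin (suc m) → Bool) (ps : Path m) : Set where
  field
    chain    : ChainFrom δ 𝔳 ps
    ends-at  : endVert 𝔳 ps ≡ 𝔴
    distinct : Unique (map proj₁ ps)
    odd-len  : Odd (length ps)
    even-crosses : (k : Fin (length ps)) → Even (suc (toℕ k)) →
                   Crosses (edgeAt ps k)
    ordered  : (k k' : Fin (length ps)) → toℕ k < toℕ k' →
               (j j' : Fin (suc (suc m))) →
               edgeAt ps k ≡ diag j → edgeAt ps k' ≡ diag j' →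
               toℕ j < toℕ j'

d : Bool → ℕ
d false = 0
d true  = 1

AdjCond : Bool → Bool → (Sp₁ Sp₂ S₁ S₂ : Subset 1) → Set
AdjCond false false Sp₁ Sp₂ S₁ S₂ = ∣ Sp₂ ∣ ≢ ∣ S₁ ∣
AdjCond true  true  Sp₁ Sp₂ S₁ S₂ = ∣ Sp₁ ∣ ≢ ∣ S₂ ∣
AdjCond false true  Sp₁ Sp₂ S₁ S₂ = ∣ Sp₂ ∣ ≡ ∣ S₂ ∣
AdjCond true  false Sp₁ Sp₂ S₁ S₂ = ∣ Sp₁ ∣ ≡ ∣ S₁ ∣

record GCC {m} (δ : Fin (suc m) → Bool) : Set where
  field
    S₁ S₂ : Fin (suc m) → Subset 1
    not11 : (i : Fin (suc m)) → ¬ (∣ S₁ i ∣ ≡ 1 × ∣ S₂ i ∣ ≡ 1)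
    adj   : (i j : Fin (suc m)) → toℕ j ≡ suc (toℕ i) →
            AdjCond (δ i) (δ j) (S₁ i) (S₂ i) (S₁ j) (S₂ j)
open GCC public

S[1+δ] : ∀ {m} {δ : Fin (suc m) → Bool} → GCC δ → Fin (suc m) → Subset 1
S[1+δ] {δ = δ} S i = if δ i then S₂ S i else S₁ S i

S[2-δ] : ∀ {m} {δ : Fin (suc m) → Bool} → GCC δ → Fin (suc m) → Subset 1
S[2-δ] {δ = δ} S i = if δ i then S₁ S i else S₂ S i

lastArrow : ∀ m → Fin (suc m)
lastArrow m = fromℕ m

lastDiag : ∀ m → Fin (suc (suc m))
lastDiag m = fromℕ (suc m)

isPair : ℕ → ℕ → ℕ → ℕ → Bool
isPair a b c e = ⌊ (a N.≟ c) ×-dec (b N.≟ e) ⌋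

α₁ : ∀ {m} {δ : Fin (suc m) → Bool} → GCC δ → Edge m
α₁ {δ = δ} S =
  if ⌊ ∣ S[1+δ] S zero ∣ N.≟ (1 ∸ d (δ zero)) ⌋ then v0 else v1

αlast : ∀ {m} {δ : Fin (suc m) → Bool} → GCC δ → Edge m
αlast {m} {δ} S =
  if ⌊ ∣ S[2-δ] S (lastArrow m) ∣ N.≟ d (δ (lastArrow m)) ⌋ then w0 else w1

-- α'_{2i+1} for i ∈ [1,n-1]  (the value for the excluded pair (1,1) is irrelevant)
αmid : ∀ {m} {δ : Fin (suc m) → Bool} → GCC δ → Fin (suc m) → Edge m
αmid {δ = δ} S i =
  let a = ∣ S₁ S i ∣ ; b = ∣ S₂ S i ∣ ; t = d (δ i) in
  if isPair a b t (1 ∸ t) then diag (inject₁ i)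
  else if isPair a b (1 ∸ t) t then diag (suc i)
  else bnd i

α′ : ∀ {m} {δ : Fin (suc m) → Bool} → GCC δ → List (Edge m)
α′ {m} S =
  α₁ S ∷ (concatMap (λ i → diag (inject₁ i) ∷ αmid S i ∷ []) (allFin (suc m))
          ++ (diag (lastDiag m) ∷ αlast S ∷ []))

-- cancelling duplicate pairs: repeatedly delete pairs of consecutive
-- identical edges, until none remain (free reduction)
cancelPairs : ∀ {m} → List (Edge m) → List (Edge m)
cancelPairs [] = []
cancelPairs (e ∷ es) with cancelPairs es
... | [] = e ∷ []
... | f ∷ fs with e ≟E f
...   | yes _ = fs
...   | no _  = e ∷ f ∷ fs

other : ∀ {m} → (Fin (suc m) → Bool) → Edge m → Vert → Vert
other δ e u with ends δ e
... | (a , b) with u ≟V a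
...   | yes _ = b
...   | no _  = a

walk : ∀ {m} → (Fin (suc m) → Bool) → Vert → List (Edge m) → Path m
walk δ u [] = []
walk δ u (e ∷ es) = (e , other δ e u) ∷ walk δ (other δ e u) es

ψ : ∀ {m} {δ : Fin (suc m) → Bool} → GCC δ → Path m
ψ {δ = δ} S = walk δ 𝔳 (cancelPairs (α′ S))

-- Laurent monomials in the variables x_e (e ∈ Q'_0), as exponent vectors

Mono : ℕ → Set
Mono m = Edge m → ℤ

𝟙 : ∀ {m} → Mono m
𝟙 _ = + 0

_·_ : ∀ {m} → Mono m → Mono m → Mono m
(p · q) f = p f +ℤ q f

_^[_] : ∀ {m} → Edge m → ℤ → Mono m
(e ^[ c ]) f = if ⌊ e ≟E f ⌋ then c else + 0

prodFin : ∀ {m} k → (Fin k → Mono m) → Mono m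
prodFin zero    g = 𝟙
prodFin (suc k) g = g zero · prodFin k (λ i → g (suc i))

yMid : ∀ {m} {δ : Fin (suc m) → Bool} → GCC δ → Fin (suc m) → Mono m
yMid {δ = δ} S i =
  let a = ∣ S₁ S i ∣ ; b = ∣ S₂ S i ∣ in
  (diag (if δ i then suc i else inject₁ i) ^[ + b ])
  · ((diag (if δ i then inject₁ i else suc i) ^[ + a ])
  · (bnd i ^[ (+ 1 Data.Integer.- + a) Data.Integer.- + b ]))

y₀ : ∀ {m} {δ : Fin (suc m) → Bool} → GCC δ → Mono m
y₀ {δ = δ} S =
  if ⌊ ∣ S[1+δ] S zero ∣ N.≟ (1 ∸ d (δ zero)) ⌋ then v0 ^[ + 1 ] else v1 ^[ + 1 ]

yₙ : ∀ {m} {δ : Fin (suc m) → Bool} → GCC δ → Mono m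
yₙ {m} {δ} S =
  if ⌊ ∣ S[2-δ] S (lastArrow m) ∣ N.≟ d (δ (lastArrow m)) ⌋ then w0 ^[ + 1 ] else w1 ^[ + 1 ]

gccWeight : ∀ {m} {δ : Fin (suc m) → Bool} → GCC δ → Mono m
gccWeight {m} S =
  prodFin (suc (suc m)) (λ j → diag j ^[ - + 1 ])
  · (y₀ S · (prodFin (suc m) (yMid S) · yₙ S))

pathWeightFrom : ∀ {m} → ℤ → Path m → Mono m
pathWeightFrom s [] = 𝟙
pathWeightFrom s ((e , _) ∷ ps) = (e ^[ s ]) · pathWeightFrom (- s) ps

x[_] : ∀ {m} → Path m → Mono m
x[ α ] = pathWeightFrom (+ 1) α

_≈G_ : ∀ {m} {δ : Fin (suc m) → Bool} → GCC δ → GCC δ → Set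
_≈G_ {m} S S' = (i : Fin (suc m)) → (S₁ S i ≡ S₁ S' i) × (S₂ S i ≡ S₂ S' i)

module Submission where

-- Cancelling duplicate pairs in α' = T_{1,•} T_1 α'_3 T_2 … α'_{2n-1} T_n T_{n,•} leaves a
-- word whose edges strictly increase in the order in which M_{𝔳,𝔴} meets them, and which is
-- assembled block by block from the choices (|S_{i,1}|, |S_{i,2}|) ∈ {(δ_i,1-δ_i), (1-δ_i,δ_i),
-- (0,0)}.  The GCC conditions on consecutive blocks say exactly that this word can be walked
-- from 𝔳 to 𝔴 with every other edge crossing M_{𝔳,𝔴}, so ψ S is a T-path.  Conversely, the
-- shape of the triangulation forces every T-path to use its edges in increasing order, so
-- reading it block by block recovers the choices, hence the GCC: this inverts ψ.  Finally
-- y_0, y_i, y_n are x_{α'_1}, x_{α'_{2i+1}}, x_{α'_{2n+1}}, so the weight of the GCC is x(α'),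
-- and cancelling a pair x_e x_e^{-1} does not change it.

open import Defs
open import Data.Nat using (ℕ; zero; suc; _+_; _∸_; _≤_; _<_; _≤′_; ≤′-refl; ≤′-step; z≤n; s≤s; s≤s⁻¹; _≟_; _≤?_; _<?_)
open import Data.Nat.Properties
open import Data.Bool using (Bool; true; false; not; if_then_else_)
import Data.Bool as Bool
open import Data.Bool.Properties using (not-involutive; not-injective)
open import Data.Fin using (Fin; zero; suc; toℕ; inject₁; fromℕ)
open import Data.Fin.Subset using (Subset; ∣_∣)
open import Data.Vec as Vec using (Vec; []; _∷_)
import Data.Fin.Properties as Fin
open import Data.List using (List; []; _∷_; _++_; map; length; lookup; concatMap; tabulate; allFin)
open import Data.List.Relation.Unary.All using (All; []; _∷_)
import Data.List.Relation.Unary.All as All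
open import Data.List.Relation.Unary.AllPairs using (AllPairs; []; _∷_)
import Data.List.Relation.Unary.AllPairs as AllPairs
open import Data.List.Relation.Unary.Linked using (Linked; [-]; _∷_)
open import Data.List.Relation.Unary.Linked.Properties using (Linked⇒AllPairs)
open import Data.List.Properties using (length-map)
import Data.List.Properties as Listₚ
import Data.Vec.Properties as Vecₚ
open import Data.Integer using (ℤ; +_)
import Data.Integer as ℤ
import Data.Integer.Properties as ℤ
open import Data.Integer.Solver using (module +-*-Solver)
open import Data.Product using (Σ; _×_; _,_; proj₁; proj₂)
open import Data.Product.Properties using (×-≡,≡→≡)
open import Data.Sum using (_⊎_; inj₁; inj₂)
open import Data.Empty using (⊥; ⊥-elim)
open import Relation.Nullary using (¬_; yes; no)
open import Relation.Nullary.Decidable using (⌊_⌋)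
open import Relation.Binary.PropositionalEquality
open import Function.Bundles using (_⇔_; mk⇔; Equivalence)
open import Function.Base using (_∘_; id)

clamp : ∀ {N} → ℕ → Fin (suc N)
clamp {zero}  _       = zero
clamp {suc N} zero    = zero
clamp {suc N} (suc n) = suc (clamp n)

toℕ-clamp : ∀ {N} n → n ≤ N → toℕ (clamp {N} n) ≡ n
toℕ-clamp {zero}  zero    _       = refl
toℕ-clamp {suc N} zero    _       = refl
toℕ-clamp {suc N} (suc n) (s≤s p) = cong suc (toℕ-clamp n p)

clamp-toℕ : ∀ {N} (i : Fin (suc N)) → clamp (toℕ i) ≡ i
clamp-toℕ {zero}  zero    = refl
clamp-toℕ {suc N} zero    = refl
clamp-toℕ {suc N} (suc i) = cong suc (clamp-toℕ i)

odd≢even : ∀ a b → suc (a + a) ≢ b + b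
odd≢even zero    zero    ()
odd≢even zero    (suc b) e with () ← trans (suc-injective e) (+-suc b b)
odd≢even (suc a) zero    ()
odd≢even (suc a) (suc b) e rewrite +-suc a a | +-suc b b =
  odd≢even a b (suc-injective (suc-injective e))

double-cancel-≤ : ∀ a b → a + a ≤ b + b → a ≤ b
double-cancel-≤ a b p with a ≤? b
... | yes a≤b = a≤b
... | no  a≰b = ⊥-elim (<⇒≱ (+-mono-< (≰⇒> a≰b) (≰⇒> a≰b)) p)

double-cancel-≤-suc : ∀ a b → a + a ≤ suc (b + b) → a ≤ b
double-cancel-≤-suc a b p with a ≤? b
... | yes a≤b = a≤b
... | no  a≰b = ⊥-elim (<⇒≱ (subst (_≤ a + a) (cong suc (+-suc b b)) (+-mono-≤ (≰⇒> a≰b) (≰⇒> a≰b))) p)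

double-injective : ∀ {a b} → a + a ≡ b + b → a ≡ b
double-injective {a} {b} e =
  ≤-antisym (double-cancel-≤ a b (≤-reflexive e)) (double-cancel-≤ b a (≤-reflexive (sym e)))

double-cancel-< : ∀ a b → suc (a + a) < suc (b + b) → a < b
double-cancel-< a b p with a <? b
... | yes a<b = a<b
... | no  a≮b = ⊥-elim (<⇒≱ p (s≤s (+-mono-≤ (≮⇒≥ a≮b) (≮⇒≥ a≮b))))

even≤odd⇒< : ∀ a b → suc (suc (a + a)) ≤ suc (b + b) → a < b
even≤odd⇒< a b p = double-cancel-≤-suc (suc a) b (subst (_≤ suc (b + b)) (sym (cong suc (+-suc a a))) p)

isEven : ℕ → Bool
isEven zero    = true
isEven (suc n) = not (isEven n)

isEven-double : ∀ t → isEven (t + t) ≡ true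
isEven-double zero    = refl
isEven-double (suc t) rewrite +-suc t t | not-involutive (isEven (t + t)) = isEven-double t

Even⇒isEven : ∀ {n} → Even n → isEven n ≡ true
Even⇒isEven (t , refl) = isEven-double t

Odd⇒isOdd : ∀ {n} → Odd n → isEven n ≡ false
Odd⇒isOdd (t , refl) = cong not (isEven-double t)

not≡⇒≡not : ∀ {a b} → not a ≡ b → a ≡ not b
not≡⇒≡not {a} refl = sym (not-involutive a)

mutual
  isEven⇒Even : ∀ n → isEven n ≡ true → Even n
  isEven⇒Even zero    _ = 0 , refl
  isEven⇒Even (suc n) e with isOdd⇒Odd n (not≡⇒≡not e)
  ... | t , refl = suc t , cong suc (sym (+-suc t t))

  isOdd⇒Odd : ∀ n → isEven n ≡ false → Odd n
  isOdd⇒Odd zero    ()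
  isOdd⇒Odd (suc n) e with isEven⇒Even n (not≡⇒≡not e)
  ... | t , refl = t , refl

indicator : Bool → Bool → ℕ
indicator x b = if ⌊ x Bool.≟ b ⌋ then 1 else 0

indicator-self : ∀ b → indicator b b ≡ 1
indicator-self true  = refl
indicator-self false = refl

count<-zero : ∀ {k} (δ : Fin k → Bool) b → count< δ b 0 ≡ 0
count<-zero {zero}  δ b = refl
count<-zero {suc k} δ b = refl

count<-suc : ∀ {k} (δ : Fin (suc k) → Bool) b (i : Fin (suc k)) →
             count< δ b (suc (toℕ i)) ≡ count< δ b (toℕ i) + indicator (δ i) b
count<-suc δ b zero rewrite count<-zero (λ i → δ (suc i)) b = +-comm (indicator (δ zero) b) 0
count<-suc {suc k} δ b (suc i) rewrite count<-suc (λ j → δ (suc j)) b i =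
  sym (+-assoc (indicator (δ zero) b) _ _)

count<-≤-suc : ∀ {k} (δ : Fin k → Bool) b o → count< δ b o ≤ count< δ b (suc o)
count<-≤-suc {zero}  δ b o       = z≤n
count<-≤-suc {suc k} δ b zero    = z≤n
count<-≤-suc {suc k} δ b (suc o) = +-monoʳ-≤ (indicator (δ zero) b) (count<-≤-suc (λ i → δ (suc i)) b o)

count<-mono : ∀ {k} (δ : Fin k → Bool) b {o o'} → o ≤ o' → count< δ b o ≤ count< δ b o'
count<-mono δ b o≤o' = go (≤⇒≤′ o≤o')
  where
  go : ∀ {o o'} → o ≤′ o' → count< δ b o ≤ count< δ b o'
  go ≤′-refl          = ≤-refl
  go (≤′-step o≤′o')  = ≤-trans (go o≤′o') (count<-≤-suc δ b _)

module _ {A B : Set} where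

  All-map₁-lookup : ∀ {P : A → Set} (qs : List (A × B)) → All P (map proj₁ qs) → ∀ k → P (proj₁ (lookup qs k))
  All-map₁-lookup (q ∷ qs) (p ∷ _)  zero    = p
  All-map₁-lookup (q ∷ qs) (_ ∷ ps) (suc k) = All-map₁-lookup qs ps k

  AllPairs-map₁-lookup : ∀ {_∼_ : A → A → Set} (qs : List (A × B)) → AllPairs _∼_ (map proj₁ qs) →
    ∀ k k' → toℕ k < toℕ k' → proj₁ (lookup qs k) ∼ proj₁ (lookup qs k')
  AllPairs-map₁-lookup (q ∷ qs) (a ∷ _)  zero    (suc k') _         = All-map₁-lookup qs a k'
  AllPairs-map₁-lookup (q ∷ qs) (_ ∷ ap) (suc k) (suc k') (s≤s lt) = AllPairs-map₁-lookup qs ap k k' lt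

  lookup-AllPairs-map₁ : ∀ {_∼_ : A → A → Set} (qs : List (A × B)) →
    (∀ k k' → toℕ k < toℕ k' → proj₁ (lookup qs k) ∼ proj₁ (lookup qs k')) → AllPairs _∼_ (map proj₁ qs)
  lookup-AllPairs-map₁ []       h = []
  lookup-AllPairs-map₁ {_∼_ = _∼_} (q ∷ qs) h =
    heads qs (λ k → h zero (suc k) (s≤s z≤n)) ∷ lookup-AllPairs-map₁ qs (λ k k' lt → h (suc k) (suc k') (s≤s lt))
    where
    heads : ∀ rs → (∀ k → proj₁ q ∼ proj₁ (lookup rs k)) → All (proj₁ q ∼_) (map proj₁ rs)
    heads []       f = []
    heads (r ∷ rs) f = f zero ∷ heads rs (λ k → f (suc k))

cancelPairs-keep : ∀ {m} (x : Edge m) ys y zs → cancelPairs ys ≡ y ∷ zs → x ≢ y → cancelPairs (x ∷ ys) ≡ x ∷ y ∷ zs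
cancelPairs-keep x ys y zs eq x≢y rewrite eq with x ≟E y
... | yes x≡y = ⊥-elim (x≢y x≡y)
... | no _    = refl

cancelPairs-cancel : ∀ {m} (x : Edge m) ys zs → cancelPairs ys ≡ x ∷ zs → cancelPairs (x ∷ ys) ≡ zs
cancelPairs-cancel x ys zs eq rewrite eq with x ≟E x
... | yes _   = refl
... | no x≢x  = ⊥-elim (x≢x refl)

side : Bool → ℕ → Vert
side true  = L
side false = R

side-injective : ∀ {σ σ' x y} → side σ x ≡ side σ' y → (σ ≡ σ') × (x ≡ y)
side-injective {true}  {true}  refl = refl , refl
side-injective {false} {false} refl = refl , refl

side≢𝔳 : ∀ {σ x} → side σ x ≢ 𝔳
side≢𝔳 {true}  ()
side≢𝔳 {false} ()

side≢𝔴 : ∀ {σ x} → side σ x ≢ 𝔴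
side≢𝔴 {true}  ()
side≢𝔴 {false} ()

side-not≢ : ∀ σ {x y} → side (not σ) x ≢ side σ y
side-not≢ true  ()
side-not≢ false ()

-- The admissible values of (|S_{i,1}|, |S_{i,2}|), named by the edge α'_{2i+1}
-- they select: T_i, T_{i+1} or T_{i,i+1}.
data Choice : Set where
  lower upper boundary : Choice

isUpper : Choice → Bool
isUpper upper = true
isUpper _     = false

choiceOf : Bool → ℕ → ℕ → Choice
choiceOf t a b =
  if isPair a b (d t) (1 ∸ d t) then lower else if isPair a b (1 ∸ d t) (d t) then upper else boundary

S₁-of S₂-of : Bool → Choice → Subset 1
S₁-of t lower    = t ∷ []
S₁-of t upper    = not t ∷ []
S₁-of t boundary = false ∷ []
S₂-of t lower    = not t ∷ []
S₂-of t upper    = t ∷ []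
S₂-of t boundary = false ∷ []

NotBoth : Subset 1 → Subset 1 → Set
NotBoth p q = ¬ (∣ p ∣ ≡ 1 × ∣ q ∣ ≡ 1)

choiceOf-S-of : ∀ t x → choiceOf t ∣ S₁-of t x ∣ ∣ S₂-of t x ∣ ≡ x
choiceOf-S-of true  lower    = refl
choiceOf-S-of true  upper    = refl
choiceOf-S-of true  boundary = refl
choiceOf-S-of false lower    = refl
choiceOf-S-of false upper    = refl
choiceOf-S-of false boundary = refl

S-of-notBoth : ∀ t x → NotBoth (S₁-of t x) (S₂-of t x)
S-of-notBoth true  lower    (_ , ())
S-of-notBoth true  upper    (() , _)
S-of-notBoth true  boundary (() , _)
S-of-notBoth false lower    (() , _)
S-of-notBoth false upper    (_ , ())
S-of-notBoth false boundary (() , _)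

S-of-choiceOf : ∀ t (p q : Subset 1) → NotBoth p q →
                (S₁-of t (choiceOf t ∣ p ∣ ∣ q ∣) ≡ p) × (S₂-of t (choiceOf t ∣ p ∣ ∣ q ∣) ≡ q)
S-of-choiceOf t     (true  ∷ []) (true  ∷ []) n = ⊥-elim (n (refl , refl))
S-of-choiceOf false (false ∷ []) (false ∷ []) n = refl , refl
S-of-choiceOf false (false ∷ []) (true  ∷ []) n = refl , refl
S-of-choiceOf false (true  ∷ []) (false ∷ []) n = refl , refl
S-of-choiceOf true  (false ∷ []) (false ∷ []) n = refl , refl
S-of-choiceOf true  (false ∷ []) (true  ∷ []) n = refl , refl
S-of-choiceOf true  (true  ∷ []) (false ∷ []) n = refl , refl

choiceOf-injective : ∀ t {p q p' q'} → NotBoth p q → NotBoth p' q' →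
                     choiceOf t (∣ p ∣) (∣ q ∣) ≡ choiceOf t (∣ p' ∣) (∣ q' ∣) → (p ≡ p') × (q ≡ q')
choiceOf-injective t {p} {q} {p'} {q'} n n' e =
  trans (sym (proj₁ view)) (trans (cong (S₁-of t) e) (proj₁ view')) ,
  trans (sym (proj₂ view)) (trans (cong (S₂-of t) e) (proj₂ view'))
  where
  view  = S-of-choiceOf t p q n
  view' = S-of-choiceOf t p' q' n'

-- Sides of M_{𝔳,𝔴} are booleans (true for L).  Let a = not δ_i be the side of the apex of
-- the triangle T_i T_{i+1} T_{i,i+1}.  If we stand on side p after α'_{2i} = T_i, then
-- Compatible x p a says that α'_{2i+1} can be walked from there; nextSide x a is then the
-- side on which the reduced walk reaches T_{i+1}, and sideAfterNextDiag x a the side we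
-- stand on after α'_{2i+2} = T_{i+1}.
Compatible : Choice → Bool → Bool → Set
Compatible upper    p a = p ≡ a
Compatible lower    p a = p ≡ not a
Compatible boundary p a = p ≡ not a

Compatible-unique : ∀ {x p p' a} → Compatible x p a → Compatible x p' a → p ≡ p'
Compatible-unique {upper}    refl refl = refl
Compatible-unique {lower}    refl refl = refl
Compatible-unique {boundary} refl refl = refl

sideAfterDiag : Bool → Bool → Bool
sideAfterDiag true  σ = σ
sideAfterDiag false σ = not σ

sideAfterNextDiag : Choice → Bool → Bool
sideAfterNextDiag lower a = not a
sideAfterNextDiag _     a = a

nextSide : Choice → Bool → Bool
nextSide boundary a = not a
nextSide _        a = a

sideAfterDiag-next : ∀ x a → sideAfterDiag (isUpper x) (nextSide x a) ≡ sideAfterNextDiag x a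
sideAfterDiag-next lower    a = refl
sideAfterDiag-next upper    a = refl
sideAfterDiag-next boundary a = not-involutive a

choice-adj⇔compatible : ∀ t t' x x' →
  AdjCond t t' (S₁-of t x) (S₂-of t x) (S₁-of t' x') (S₂-of t' x') ⇔
  Compatible x' (sideAfterNextDiag x (not t)) (not t')
choice-adj⇔compatible false false lower    lower    = mk⇔ (λ _ → refl) (λ _ → λ ())
choice-adj⇔compatible false false lower    upper    = mk⇔ (λ c → ⊥-elim (c refl)) (λ ())
choice-adj⇔compatible false false lower    boundary = mk⇔ (λ _ → refl) (λ _ → λ ())
choice-adj⇔compatible false false upper    lower    = mk⇔ (λ c → ⊥-elim (c refl)) (λ ())
choice-adj⇔compatible false false upper    upper    = mk⇔ (λ _ → refl) (λ _ → λ ())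
choice-adj⇔compatible false false upper    boundary = mk⇔ (λ c → ⊥-elim (c refl)) (λ ())
choice-adj⇔compatible false false boundary lower    = mk⇔ (λ c → ⊥-elim (c refl)) (λ ())
choice-adj⇔compatible false false boundary upper    = mk⇔ (λ _ → refl) (λ _ → λ ())
choice-adj⇔compatible false false boundary boundary = mk⇔ (λ c → ⊥-elim (c refl)) (λ ())
choice-adj⇔compatible false true  lower    lower    = mk⇔ (λ ()) (λ ())
choice-adj⇔compatible false true  lower    upper    = mk⇔ (λ _ → refl) (λ _ → refl)
choice-adj⇔compatible false true  lower    boundary = mk⇔ (λ ()) (λ ())
choice-adj⇔compatible false true  upper    lower    = mk⇔ (λ _ → refl) (λ _ → refl)
choice-adj⇔compatible false true  upper    upper    = mk⇔ (λ ()) (λ ())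
choice-adj⇔compatible false true  upper    boundary = mk⇔ (λ _ → refl) (λ _ → refl)
choice-adj⇔compatible false true  boundary lower    = mk⇔ (λ _ → refl) (λ _ → refl)
choice-adj⇔compatible false true  boundary upper    = mk⇔ (λ ()) (λ ())
choice-adj⇔compatible false true  boundary boundary = mk⇔ (λ _ → refl) (λ _ → refl)
choice-adj⇔compatible true  false lower    lower    = mk⇔ (λ ()) (λ ())
choice-adj⇔compatible true  false lower    upper    = mk⇔ (λ _ → refl) (λ _ → refl)
choice-adj⇔compatible true  false lower    boundary = mk⇔ (λ ()) (λ ())
choice-adj⇔compatible true  false upper    lower    = mk⇔ (λ _ → refl) (λ _ → refl)
choice-adj⇔compatible true  false upper    upper    = mk⇔ (λ ()) (λ ())
choice-adj⇔compatible true  false upper    boundary = mk⇔ (λ _ → refl) (λ _ → refl)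
choice-adj⇔compatible true  false boundary lower    = mk⇔ (λ _ → refl) (λ _ → refl)
choice-adj⇔compatible true  false boundary upper    = mk⇔ (λ ()) (λ ())
choice-adj⇔compatible true  false boundary boundary = mk⇔ (λ _ → refl) (λ _ → refl)
choice-adj⇔compatible true  true  lower    lower    = mk⇔ (λ _ → refl) (λ _ → λ ())
choice-adj⇔compatible true  true  lower    upper    = mk⇔ (λ c → ⊥-elim (c refl)) (λ ())
choice-adj⇔compatible true  true  lower    boundary = mk⇔ (λ _ → refl) (λ _ → λ ())
choice-adj⇔compatible true  true  upper    lower    = mk⇔ (λ c → ⊥-elim (c refl)) (λ ())
choice-adj⇔compatible true  true  upper    upper    = mk⇔ (λ _ → refl) (λ _ → λ ())
choice-adj⇔compatible true  true  upper    boundary = mk⇔ (λ c → ⊥-elim (c refl)) (λ ())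
choice-adj⇔compatible true  true  boundary lower    = mk⇔ (λ c → ⊥-elim (c refl)) (λ ())
choice-adj⇔compatible true  true  boundary upper    = mk⇔ (λ _ → refl) (λ _ → λ ())
choice-adj⇔compatible true  true  boundary boundary = mk⇔ (λ c → ⊥-elim (c refl)) (λ ())

adj⇒compatible : ∀ t t' {p q p' q'} → NotBoth p q → NotBoth p' q' → AdjCond t t' p q p' q' →
  Compatible (choiceOf t' ∣ p' ∣ ∣ q' ∣) (sideAfterNextDiag (choiceOf t ∣ p ∣ ∣ q ∣) (not t)) (not t')
adj⇒compatible t t' {p} {q} {p'} {q'} n n' c =
  Equivalence.to (choice-adj⇔compatible t t' _ _)
    (subst₂ (λ P Q → AdjCond t t' (proj₁ P) (proj₂ P) (proj₁ Q) (proj₂ Q))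
            (sym (×-≡,≡→≡ (S-of-choiceOf t p q n))) (sym (×-≡,≡→≡ (S-of-choiceOf t' p' q' n'))) c)

vEdge wEdge : ∀ {m} → Bool → Edge m
vEdge true  = v1
vEdge false = v0
wEdge true  = w0
wEdge false = w1

firstEdge-choice : ∀ {m} t (p q : Subset 1) → NotBoth p q → Σ Bool λ σ →
  ((if ⌊ ∣ (if t then q else p) ∣ ≟ (1 ∸ d t) ⌋ then v0 else v1) ≡ vEdge {m} σ) ×
  Compatible (choiceOf t ∣ p ∣ ∣ q ∣) (not σ) (not t)
firstEdge-choice t     (true  ∷ []) (true  ∷ []) n = ⊥-elim (n (refl , refl))
firstEdge-choice false (false ∷ []) (false ∷ []) n = true  , refl , refl
firstEdge-choice false (false ∷ []) (true  ∷ []) n = true  , refl , refl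
firstEdge-choice false (true  ∷ []) (false ∷ []) n = false , refl , refl
firstEdge-choice true  (false ∷ []) (false ∷ []) n = false , refl , refl
firstEdge-choice true  (false ∷ []) (true  ∷ []) n = true  , refl , refl
firstEdge-choice true  (true  ∷ []) (false ∷ []) n = false , refl , refl

lastEdge-choice : ∀ {m} t (p q : Subset 1) → NotBoth p q →
  _≡_ {A = Edge m} (if ⌊ ∣ (if t then p else q) ∣ ≟ d t ⌋ then w0 else w1)
                   (wEdge (sideAfterNextDiag (choiceOf t ∣ p ∣ ∣ q ∣) (not t)))
lastEdge-choice t     (true  ∷ []) (true  ∷ []) n = ⊥-elim (n (refl , refl))
lastEdge-choice false (false ∷ []) (false ∷ []) n = refl
lastEdge-choice false (false ∷ []) (true  ∷ []) n = refl
lastEdge-choice false (true  ∷ []) (false ∷ []) n = refl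
lastEdge-choice true  (false ∷ []) (false ∷ []) n = refl
lastEdge-choice true  (false ∷ []) (true  ∷ []) n = refl
lastEdge-choice true  (true  ∷ []) (false ∷ []) n = refl

+-interleave : ∀ (a b c d e : ℤ) → a ℤ.+ (b ℤ.+ (c ℤ.+ (d ℤ.+ e))) ≡ (a ℤ.+ c) ℤ.+ ((b ℤ.+ d) ℤ.+ e)
+-interleave = solve 5 (λ a b c d e → a :+ (b :+ (c :+ (d :+ e))) := (a :+ c) :+ ((b :+ d) :+ e)) refl
  where open +-*-Solver

sumFrom : ℕ → ℕ → (ℕ → ℤ) → ℤ
sumFrom zero    o g = + 0
sumFrom (suc n) o g = g o ℤ.+ sumFrom n (suc o) g

module _ {m : ℕ} where

  wordWeight : ℤ → List (Edge m) → Edge m → ℤ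
  wordWeight s []       f = + 0
  wordWeight s (e ∷ es) f = (e ^[ s ]) f ℤ.+ wordWeight (ℤ.- s) es f

  pathWeightFrom-walk : ∀ δ s u es f → pathWeightFrom s (walk δ u es) f ≡ wordWeight s es f
  pathWeightFrom-walk δ s u []       f = refl
  pathWeightFrom-walk δ s u (e ∷ es) f = cong (λ z → (e ^[ s ]) f ℤ.+ z) (pathWeightFrom-walk δ (ℤ.- s) (other δ e u) es f)

  ^[]-cancel : ∀ s (e f : Edge m) x → (e ^[ s ]) f ℤ.+ ((e ^[ ℤ.- s ]) f ℤ.+ x) ≡ x
  ^[]-cancel s e f x with ⌊ e ≟E f ⌋
  ... | true  = solve 2 (λ s x → s :+ (:- s :+ x) := x) refl s x
    where open +-*-Solver
  ... | false = trans (ℤ.+-identityˡ _) (ℤ.+-identityˡ x)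

  ^[+0] : ∀ (e f : Edge m) → (e ^[ + 0 ]) f ≡ + 0
  ^[+0] e f with ⌊ e ≟E f ⌋
  ... | true  = refl
  ... | false = refl

  wordWeight-cancelPairs : ∀ s es f → wordWeight s (cancelPairs es) f ≡ wordWeight s es f
  wordWeight-cancelPairs s []       f = refl
  wordWeight-cancelPairs s (e ∷ es) f with cancelPairs es | wordWeight-cancelPairs (ℤ.- s) es f
  ... | []     | ih = cong (λ z → (e ^[ s ]) f ℤ.+ z) ih
  ... | g ∷ gs | ih with e ≟E g
  ...   | no _     = cong (λ z → (e ^[ s ]) f ℤ.+ z) ih
  ...   | yes refl = begin
    wordWeight s gs f
      ≡⟨ ^[]-cancel s e f _ ⟨
    (e ^[ s ]) f ℤ.+ ((e ^[ ℤ.- s ]) f ℤ.+ wordWeight s gs f)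
      ≡⟨ cong (λ t → (e ^[ s ]) f ℤ.+ ((e ^[ ℤ.- s ]) f ℤ.+ wordWeight t gs f)) (ℤ.neg-involutive s) ⟨
    (e ^[ s ]) f ℤ.+ wordWeight (ℤ.- s) (e ∷ gs) f
      ≡⟨ cong (λ z → (e ^[ s ]) f ℤ.+ z) ih ⟩
    (e ^[ s ]) f ℤ.+ wordWeight (ℤ.- s) es f ∎
    where open ≡-Reasoning

  prodFin-sumFrom : ∀ n o (g : Fin n → Mono m) (G : ℕ → ℤ) f → (∀ j → g j f ≡ G (toℕ j + o)) →
                    prodFin n g f ≡ sumFrom n o G
  prodFin-sumFrom zero    o g G f h = refl
  prodFin-sumFrom (suc n) o g G f h = cong₂ ℤ._+_ (h zero)
    (prodFin-sumFrom n (suc o) (g ∘ suc) G f (λ j → trans (h (suc j)) (cong G (sym (+-suc (toℕ j) o)))))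

  -- y_i is x_e for the edge e = α'_{2i+1} it selects.
  yMid-monomial : ∀ t (p q : Subset 1) → NotBoth p q → ∀ (a b : Fin (suc (suc m))) (c f : Edge m) →
    (diag (if t then b else a) ^[ + ∣ q ∣ ]) f ℤ.+ ((diag (if t then a else b) ^[ + ∣ p ∣ ]) f ℤ.+
      (c ^[ (+ 1 ℤ.- + ∣ p ∣) ℤ.- + ∣ q ∣ ]) f)
    ≡ ((if isPair ∣ p ∣ ∣ q ∣ (d t) (1 ∸ d t) then diag a else if isPair ∣ p ∣ ∣ q ∣ (1 ∸ d t) (d t) then diag b else c)
        ^[ + 1 ]) f
  yMid-monomial t (true ∷ []) (true ∷ []) n a b c f = ⊥-elim (n (refl , refl))
  yMid-monomial false (false ∷ []) (false ∷ []) n a b c f rewrite ^[+0] (diag a) f | ^[+0] (diag b) f =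
    trans (ℤ.+-identityˡ _) (ℤ.+-identityˡ _)
  yMid-monomial false (false ∷ []) (true ∷ []) n a b c f rewrite ^[+0] (diag b) f | ^[+0] c f = ℤ.+-identityʳ _
  yMid-monomial false (true ∷ []) (false ∷ []) n a b c f rewrite ^[+0] (diag a) f | ^[+0] c f =
    trans (ℤ.+-identityˡ _) (ℤ.+-identityʳ _)
  yMid-monomial true (false ∷ []) (false ∷ []) n a b c f rewrite ^[+0] (diag a) f | ^[+0] (diag b) f =
    trans (ℤ.+-identityˡ _) (ℤ.+-identityˡ _)
  yMid-monomial true (false ∷ []) (true ∷ []) n a b c f rewrite ^[+0] (diag a) f | ^[+0] c f = ℤ.+-identityʳ _
  yMid-monomial true (true ∷ []) (false ∷ []) n a b c f rewrite ^[+0] (diag b) f | ^[+0] c f =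
    trans (ℤ.+-identityˡ _) (ℤ.+-identityʳ _)

module _ (m : ℕ) (δ : Fin (suc m) → Bool) where

  -- Diagonals and arrows indexed by ℕ (clamped into range): diagAt o = T_{o+1},
  -- bndAt o = T_{o+1,o+2}; corner σ o is the endpoint of T_{o+1} on side σ.
  arrowAt : ℕ → Fin (suc m)
  arrowAt = clamp

  δAt : ℕ → Bool
  δAt o = δ (arrowAt o)

  diagAt bndAt : ℕ → Edge m
  diagAt o = diag (clamp o)
  bndAt  o = bnd (arrowAt o)

  height : Bool → ℕ → ℕ
  height σ o = count< δ σ o

  corner : Bool → ℕ → Vert
  corner σ o = side σ (height σ o)

  ends-bnd : ∀ i → ends δ (bnd i) ≡ (side (δ i) (height (δ i) (toℕ i)) , side (δ i) (suc (height (δ i) (toℕ i))))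
  ends-bnd i with δ i
  ... | true  = refl
  ... | false = refl

  height-suc : ∀ σ o → o ≤ m → height σ (suc o) ≡ height σ o + indicator (δAt o) σ
  height-suc σ o o≤m =
    subst (λ t → height σ (suc t) ≡ height σ t + indicator (δAt o) σ) (toℕ-clamp o o≤m) (count<-suc δ σ (arrowAt o))

  -- Crossing arrow o, the corner on side δ_o moves and the apex on the other side stays.
  height-suc-moving : ∀ o → o ≤ m → height (δAt o) (suc o) ≡ suc (height (δAt o) o)
  height-suc-moving o o≤m = begin
    height (δAt o) (suc o)                      ≡⟨ height-suc (δAt o) o o≤m ⟩
    height (δAt o) o + indicator (δAt o) (δAt o) ≡⟨ cong (λ z → height (δAt o) o + z) (indicator-self (δAt o)) ⟩
    height (δAt o) o + 1                        ≡⟨ +-comm _ 1 ⟩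
    suc (height (δAt o) o)                      ∎
    where open ≡-Reasoning

  corner-apex : ∀ o → o ≤ m → corner (not (δAt o)) (suc o) ≡ corner (not (δAt o)) o
  corner-apex o o≤m = cong (side (not (δAt o))) (trans (height-suc (not (δAt o)) o o≤m) (apex (δAt o)))
    where
    apex : ∀ b → height (not b) o + indicator b (not b) ≡ height (not b) o
    apex true  = +-identityʳ _
    apex false = +-identityʳ _

  height-moving-< : ∀ o o' → o ≤ m → o < o' → suc (height (δAt o) o) ≤ height (δAt o) o'
  height-moving-< o o' o≤m o<o' = subst (_≤ height (δAt o) o') (height-suc-moving o o≤m) (count<-mono δ (δAt o) o<o')

  ends-diagAt : ∀ o → o ≤ suc m → ends δ (diagAt o) ≡ (corner true o , corner false o)
  ends-diagAt o o≤ rewrite toℕ-clamp {suc m} o o≤ = refl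

  ends-bndAt : ∀ o → o ≤ m → ends δ (bndAt o) ≡ (corner (δAt o) o , corner (δAt o) (suc o))
  ends-bndAt o o≤m = trans (ends-bnd (arrowAt o))
    (subst (λ t → (side (δAt o) (height (δAt o) t) , side (δAt o) (suc (height (δAt o) t)))
                ≡ (corner (δAt o) o , corner (δAt o) (suc o)))
           (sym (toℕ-clamp o o≤m)) (cong (λ z → (corner (δAt o) o , side (δAt o) z)) (sym (height-suc-moving o o≤m))))

  Incident : Edge m → Vert → Set
  Incident e w = (proj₁ (ends δ e) ≡ w) ⊎ (proj₂ (ends δ e) ≡ w)

  Joins⇒Incident₁ : ∀ {e u u'} → Joins δ e u u' → Incident e u
  Joins⇒Incident₁ (inj₁ eq) = inj₁ (cong proj₁ eq)
  Joins⇒Incident₁ (inj₂ eq) = inj₂ (cong proj₂ eq)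

  Joins⇒Incident₂ : ∀ {e u u'} → Joins δ e u u' → Incident e u'
  Joins⇒Incident₂ (inj₁ eq) = inj₂ (cong proj₂ eq)
  Joins⇒Incident₂ (inj₂ eq) = inj₁ (cong proj₁ eq)

  Joins-ends : ∀ {e u u' a b} → Joins δ e u u' → ends δ e ≡ (a , b) → (u ≡ a × u' ≡ b) ⊎ (u ≡ b × u' ≡ a)
  Joins-ends (inj₁ eq) e = inj₁ (cong proj₁ (trans (sym eq) e) , cong proj₂ (trans (sym eq) e))
  Joins-ends (inj₂ eq) e = inj₂ (cong proj₂ (trans (sym eq) e) , cong proj₁ (trans (sym eq) e))

  Joins-other : ∀ {e u u' a b} → Joins δ e u u' → ends δ e ≡ (a , b) → u ≡ a → a ≢ b → u' ≡ b
  Joins-other {e} j ends≡ u≡a a≢b with Joins-ends {e} j ends≡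
  ... | inj₁ (_ , u'≡b) = u'≡b
  ... | inj₂ (u≡b , _)  = ⊥-elim (a≢b (trans (sym u≡a) u≡b))

  Incident-ends : ∀ {e w a b} → Incident e w → ends δ e ≡ (a , b) → (w ≡ a) ⊎ (w ≡ b)
  Incident-ends (inj₁ x) e = inj₁ (trans (sym x) (cong proj₁ e))
  Incident-ends (inj₂ x) e = inj₂ (trans (sym x) (cong proj₂ e))

  Incident-𝔳 : ∀ {e} → Incident e 𝔳 → (e ≡ v0) ⊎ (e ≡ v1)
  Incident-𝔳 {diag j} (inj₁ ())
  Incident-𝔳 {diag j} (inj₂ ())
  Incident-𝔳 {bnd i} x with Incident-ends x (ends-bnd i)
  ... | inj₁ e = ⊥-elim (side≢𝔳 (sym e))
  ... | inj₂ e = ⊥-elim (side≢𝔳 (sym e))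
  Incident-𝔳 {v0} x = inj₁ refl
  Incident-𝔳 {v1} x = inj₂ refl
  Incident-𝔳 {w0} (inj₁ ())
  Incident-𝔳 {w0} (inj₂ ())
  Incident-𝔳 {w1} (inj₁ ())
  Incident-𝔳 {w1} (inj₂ ())

  Incident-𝔴 : ∀ {e} → Incident e 𝔴 → (e ≡ w0) ⊎ (e ≡ w1)
  Incident-𝔴 {diag j} (inj₁ ())
  Incident-𝔴 {diag j} (inj₂ ())
  Incident-𝔴 {bnd i} x with Incident-ends x (ends-bnd i)
  ... | inj₁ e = ⊥-elim (side≢𝔴 (sym e))
  ... | inj₂ e = ⊥-elim (side≢𝔴 (sym e))
  Incident-𝔴 {v0} (inj₁ ())
  Incident-𝔴 {v0} (inj₂ ())
  Incident-𝔴 {v1} (inj₁ ())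
  Incident-𝔴 {v1} (inj₂ ())
  Incident-𝔴 {w0} x = inj₁ refl
  Incident-𝔴 {w1} x = inj₂ refl

  -- Edges met going up along M_{𝔳,𝔴}: T_{1,0}/T_{1,1}, then T_{o+1} and T_{o+1,o+2}
  -- alternately, finally T_{n,0}/T_{n,1}.  A T-path uses edges of increasing rank.
  topRank : ℕ
  topRank = suc (suc (suc (suc (suc (m + m)))))

  rank : Edge m → ℕ
  rank (diag j) = suc (toℕ j + toℕ j)
  rank (bnd j)  = suc (suc (toℕ j + toℕ j))
  rank v0       = 0
  rank v1       = 0
  rank w0       = topRank
  rank w1       = topRank

  rank-diagAt : ∀ o → o ≤ suc m → rank (diagAt o) ≡ suc (o + o)
  rank-diagAt o o≤ rewrite toℕ-clamp {suc m} o o≤ = refl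

  rank-bndAt : ∀ o → o ≤ m → rank (bndAt o) ≡ suc (suc (o + o))
  rank-bndAt o o≤m rewrite toℕ-clamp {m} o o≤m = refl

  rank-vEdge : ∀ σ → rank (vEdge σ) ≡ 0
  rank-vEdge true  = refl
  rank-vEdge false = refl

  rank-wEdge : ∀ σ → rank (wEdge σ) ≡ topRank
  rank-wEdge true  = refl
  rank-wEdge false = refl

  double-≤ : ∀ {o} → o ≤ suc m → o + o ≤ suc (suc (m + m))
  double-≤ {o} o≤ = subst (o + o ≤_) (cong suc (+-suc m m)) (+-mono-≤ o≤ o≤)

  rank-crossing-≤ : ∀ {e} → Crosses e → rank e ≤ suc (suc (suc (m + m)))
  rank-crossing-≤ (j , refl) = s≤s (double-≤ (Fin.toℕ≤pred[n] j))

  rank-diag<topRank : ∀ j → rank (diag j) < topRank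
  rank-diag<topRank j = ≤-trans (s≤s (rank-crossing-≤ (j , refl))) (n≤1+n _)

  topRank≢odd : ∀ o → o ≤ suc m → topRank ≢ suc (o + o)
  topRank≢odd o o≤ eq = 1+n≰n (≤-trans (n≤1+n _)
    (s≤s⁻¹ (s≤s⁻¹ (subst (_≤ suc (suc (m + m))) (sym (suc-injective eq)) (double-≤ o≤)))))

  topRank≢even : ∀ o → topRank ≢ suc (suc (o + o))
  topRank≢even o eq =
    odd≢even (suc m) o (trans (cong (λ z → suc (suc z)) (+-suc m m)) (suc-injective (suc-injective eq)))

  rank-odd⇒diagAt : ∀ e o → o ≤ suc m → rank e ≡ suc (o + o) → e ≡ diagAt o
  rank-odd⇒diagAt (diag j) o o≤ eq =
    cong diag (Fin.toℕ-injective (trans (double-injective (suc-injective eq)) (sym (toℕ-clamp o o≤))))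
  rank-odd⇒diagAt (bnd j) o o≤ eq = ⊥-elim (odd≢even (toℕ j) o (suc-injective eq))
  rank-odd⇒diagAt v0 o o≤ ()
  rank-odd⇒diagAt v1 o o≤ ()
  rank-odd⇒diagAt w0 o o≤ eq = ⊥-elim (topRank≢odd o o≤ eq)
  rank-odd⇒diagAt w1 o o≤ eq = ⊥-elim (topRank≢odd o o≤ eq)

  rank-even⇒bndAt : ∀ e o → o ≤ m → rank e ≡ suc (suc (o + o)) → e ≡ bndAt o
  rank-even⇒bndAt (diag j) o o≤m eq = ⊥-elim (odd≢even o (toℕ j) (sym (suc-injective eq)))
  rank-even⇒bndAt (bnd j) o o≤m eq =
    cong bnd (Fin.toℕ-injective (trans (double-injective (suc-injective (suc-injective eq))) (sym (toℕ-clamp o o≤m))))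
  rank-even⇒bndAt v0 o o≤m ()
  rank-even⇒bndAt v1 o o≤m ()
  rank-even⇒bndAt w0 o o≤m eq = ⊥-elim (topRank≢even o eq)
  rank-even⇒bndAt w1 o o≤m eq = ⊥-elim (topRank≢even o eq)

  rank-top⇒w : ∀ e → suc (suc (suc (suc (m + m)))) ≤ rank e → (e ≡ w0) ⊎ (e ≡ w1)
  rank-top⇒w (diag j) p = ⊥-elim (1+n≰n (≤-trans p (rank-crossing-≤ (j , refl))))
  rank-top⇒w (bnd j) p = ⊥-elim (1+n≰n (≤-trans (n≤1+n _) (s≤s⁻¹ (s≤s⁻¹ (≤-trans p
                           (s≤s (s≤s (+-mono-≤ (Fin.toℕ≤pred[n] j) (Fin.toℕ≤pred[n] j)))))))))
  rank-top⇒w v0 ()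
  rank-top⇒w v1 ()
  rank-top⇒w w0 p = inj₁ refl
  rank-top⇒w w1 p = inj₂ refl

  moving-corner≢later : ∀ o o' σ → o ≤ m → o < o' → corner (δAt o) o ≢ corner σ o'
  moving-corner≢later o o' σ o≤m o<o' eq with side-injective eq
  ... | refl , e = 1+n≰n (subst (suc (height (δAt o) o) ≤_) (sym e) (height-moving-< o o' o≤m o<o'))

  moving-corner≢later-suc : ∀ o o' σ → o ≤ m → o < o' → corner (δAt o) o ≢ side σ (suc (height σ o'))
  moving-corner≢later-suc o o' σ o≤m o<o' eq with side-injective eq
  ... | refl , e = 1+n≰n (≤-trans (n≤1+n _) (subst (λ z → suc z ≤ height (δAt o) o') e (height-moving-< o o' o≤m o<o')))

  moving-corner-edge : ∀ o e → o ≤ m → Incident e (corner (δAt o) o) → suc (suc (o + o)) ≤ rank e → e ≡ bndAt o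
  moving-corner-edge o (diag j) o≤m (inj₁ x) r = ⊥-elim (moving-corner≢later o (toℕ j) true o≤m (even≤odd⇒< o (toℕ j) r) (sym x))
  moving-corner-edge o (diag j) o≤m (inj₂ x) r = ⊥-elim (moving-corner≢later o (toℕ j) false o≤m (even≤odd⇒< o (toℕ j) r) (sym x))
  moving-corner-edge o (bnd j) o≤m x r with m≤n⇒m<n∨m≡n (double-cancel-≤ o (toℕ j) (s≤s⁻¹ (s≤s⁻¹ r)))
  ... | inj₂ eq = cong bnd (Fin.toℕ-injective (trans (sym eq) (sym (toℕ-clamp o o≤m))))
  ... | inj₁ lt with Incident-ends x (ends-bnd j)
  ...   | inj₁ e = ⊥-elim (moving-corner≢later o (toℕ j) (δ j) o≤m lt e)
  ...   | inj₂ e = ⊥-elim (moving-corner≢later-suc o (toℕ j) (δ j) o≤m lt e)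
  moving-corner-edge o v0 o≤m x ()
  moving-corner-edge o v1 o≤m x ()
  moving-corner-edge o w0 o≤m (inj₁ x) r = ⊥-elim (side≢𝔴 (sym x))
  moving-corner-edge o w0 o≤m (inj₂ x) r = ⊥-elim (moving-corner≢later o (suc m) true o≤m (s≤s o≤m) (sym x))
  moving-corner-edge o w1 o≤m (inj₁ x) r = ⊥-elim (side≢𝔴 (sym x))
  moving-corner-edge o w1 o≤m (inj₂ x) r = ⊥-elim (moving-corner≢later o (suc m) false o≤m (s≤s o≤m) (sym x))

  bndAt-avoids-apex : ∀ o → o ≤ m → ¬ Incident (bndAt o) (corner (not (δAt o)) o)
  bndAt-avoids-apex o o≤m x with Incident-ends x (ends-bndAt o o≤m)
  ... | inj₁ e = side-not≢ (δAt o) e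
  ... | inj₂ e = side-not≢ (δAt o) e

  diagAt-other : ∀ o σ {u'} → o ≤ suc m → Joins δ (diagAt o) (corner σ o) u' → u' ≡ corner (not σ) o
  diagAt-other o true o≤ j with Joins-ends {diagAt o} j (ends-diagAt o o≤)
  ... | inj₁ (_ , e) = e
  ... | inj₂ (e , _) = ⊥-elim (side-not≢ false e)
  diagAt-other o false o≤ j with Joins-ends {diagAt o} j (ends-diagAt o o≤)
  ... | inj₁ (e , _) = ⊥-elim (side-not≢ true e)
  ... | inj₂ (_ , e) = e

  bndAt-other : ∀ o {u'} → o ≤ m → Joins δ (bndAt o) (corner (δAt o) o) u' → u' ≡ corner (δAt o) (suc o)
  bndAt-other o o≤m j = Joins-other {bndAt o} j (ends-bndAt o o≤m) refl
    λ e → 1+n≰n (≤-reflexive (trans (sym (height-suc-moving o o≤m)) (sym (proj₂ (side-injective e)))))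

  wEdge-from-top : ∀ σ {e u'} → Joins δ e (corner σ (suc m)) u' → (e ≡ w0) ⊎ (e ≡ w1) → (e ≡ wEdge σ) × (u' ≡ 𝔴)
  wEdge-from-top σ j (inj₁ refl) with Joins-ends {w0} j refl
  ... | inj₁ (e , _) = ⊥-elim (side≢𝔴 e)
  ... | inj₂ (e , u) with side-injective {σ' = true} e
  ...   | refl , _ = refl , u
  wEdge-from-top σ j (inj₂ refl) with Joins-ends {w1} j refl
  ... | inj₁ (e , _) = ⊥-elim (side≢𝔴 e)
  ... | inj₂ (e , u) with side-injective {σ' = false} e
  ...   | refl , _ = refl , u

  middleEdge : ℕ → Choice → Edge m
  middleEdge i lower    = diagAt i
  middleEdge i upper    = diagAt (suc i)
  middleEdge i boundary = bndAt i

  -- α' from T_{i+1} on: T_{i+1}, α'_{2i+3}, T_{i+2}, …, T_n, wl.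
  rawWord : (k i : ℕ) → Vec Choice k → Edge m → List (Edge m)
  rawWord zero    i []       wl = diagAt i ∷ wl ∷ []
  rawWord (suc k) i (x ∷ xs) wl = diagAt i ∷ middleEdge i x ∷ rawWord k (suc i) xs wl

  -- What survives of T_{i+1} α'_{2i+3} after cancellation; h records whether T_{i+1}
  -- was already cancelled against the previous middle edge (h = true iff that one was
  -- upper).
  reducedBlock : ℕ → Bool → Choice → List (Edge m)
  reducedBlock i true  lower    = diagAt i ∷ []
  reducedBlock i false lower    = []
  reducedBlock i true  upper    = []
  reducedBlock i false upper    = diagAt i ∷ []
  reducedBlock i true  boundary = bndAt i ∷ []
  reducedBlock i false boundary = diagAt i ∷ bndAt i ∷ []

  reducedWord : (k i : ℕ) → Bool → Vec Choice k → Edge m → List (Edge m)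
  reducedWord zero    i true  []       wl = wl ∷ []
  reducedWord zero    i false []       wl = diagAt i ∷ wl ∷ []
  reducedWord (suc k) i h     (x ∷ xs) wl = reducedBlock i h x ++ reducedWord k (suc i) (isUpper x) xs wl

  -- The walk along the reduced word starting at corner σ i exists iff every choice
  -- is compatible with the side reached so far, and wl ends at the side reached last.
  Admissible : (k i : ℕ) → Bool → Bool → Vec Choice k → Edge m → Set
  Admissible zero    i h σ []       wl = wl ≡ wEdge (sideAfterDiag h σ)
  Admissible (suc k) i h σ (x ∷ xs) wl =
    Compatible x (sideAfterDiag h σ) (not (δAt i)) ×
    Admissible k (suc i) (isUpper x) (nextSide x (not (δAt i))) xs wl

  Alternating : Bool → List (Edge m) → Set
  Alternating p     []       = p ≡ true
  Alternating true  (e ∷ es) = Crosses e × Alternating false es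
  Alternating false (e ∷ es) = Alternating true es

  record Reaches𝔴 (u : Vert) (es : List (Edge m)) : Set where
    constructor reaches
    field
      chain  : ChainFrom δ u (walk δ u es)
      ends-at : endVert u (walk δ u es) ≡ 𝔴

  other-Joins : ∀ e {u u'} → Joins δ e u u' → other δ e u ≡ u'
  other-Joins e {u} {u'} (inj₁ eq) rewrite eq with u ≟V u
  ... | yes _ = refl
  ... | no u≢u = ⊥-elim (u≢u refl)
  other-Joins e {u} {u'} (inj₂ eq) rewrite eq with u ≟V u'
  ... | yes u≡u' = u≡u'
  ... | no _     = refl

  walk-Joins : ∀ e {u u' es} → Joins δ e u u' → walk δ u (e ∷ es) ≡ (e , u') ∷ walk δ u' es
  walk-Joins e {es = es} j = cong (λ z → (e , z) ∷ walk δ z es) (other-Joins e j)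

  reaches-∷ : ∀ e {u u' es} → Joins δ e u u' → Reaches𝔴 u' es → Reaches𝔴 u (e ∷ es)
  reaches-∷ e {u} {u'} {es} j (reaches c t) = reaches
    (subst (λ z → Joins δ e u z × ChainFrom δ z (walk δ z es)) (sym (other-Joins e j)) (j , c))
    (subst (λ z → endVert z (walk δ z es) ≡ 𝔴) (sym (other-Joins e j)) t)

  reaches-[] : Reaches𝔴 𝔴 []
  reaches-[] = reaches _ refl

  joins-diagAt : ∀ o σ → o ≤ suc m → Joins δ (diagAt o) (corner σ o) (corner (not σ) o)
  joins-diagAt o true  o≤ = inj₁ (ends-diagAt o o≤)
  joins-diagAt o false o≤ = inj₂ (ends-diagAt o o≤)

  joins-bndAt : ∀ o → o ≤ m → Joins δ (bndAt o) (corner (δAt o) o) (corner (δAt o) (suc o))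
  joins-bndAt o o≤m = inj₁ (ends-bndAt o o≤m)

  joins-vEdge : ∀ σ → Joins δ (vEdge σ) 𝔳 (corner σ 0)
  joins-vEdge true  = inj₁ refl
  joins-vEdge false = inj₁ refl

  joins-wEdge : ∀ σ → Joins δ (wEdge σ) (corner σ (suc m)) 𝔴
  joins-wEdge true  = inj₂ refl
  joins-wEdge false = inj₂ refl

  remaining⇒≤m : ∀ k i → suc k + i ≡ suc m → i ≤ m
  remaining⇒≤m k i eq = subst (i ≤_) (suc-injective eq) (m≤n+m i k)

  apex-stays : ∀ i a → i ≤ m → δAt i ≡ a → corner (not a) (suc i) ≡ corner (not a) i
  apex-stays i a i≤m refl = corner-apex i i≤m

  joins-bndAt′ : ∀ i a → i ≤ m → δAt i ≡ a → Joins δ (bndAt i) (corner a i) (corner a (suc i))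
  joins-bndAt′ i a i≤m refl = joins-bndAt i i≤m

  reducedBlock-reaches : ∀ i h σ x a {rest} → i ≤ m → δAt i ≡ a →
    Compatible x (sideAfterDiag h σ) (not a) → Reaches𝔴 (corner (nextSide x (not a)) (suc i)) rest →
    Reaches𝔴 (corner σ i) (reducedBlock i h x ++ rest)
  reducedBlock-reaches i h σ x a {rest} i≤m δi c r = go h σ x a δi c r
    where
    i≤ = m≤n⇒m≤1+n i≤m
    apex : ∀ a → δAt i ≡ a → Reaches𝔴 (corner (not a) (suc i)) rest → Reaches𝔴 (corner (not a) i) rest
    apex a δi = subst (λ z → Reaches𝔴 z rest) (apex-stays i a i≤m δi)
    go : ∀ h σ x a → δAt i ≡ a → Compatible x (sideAfterDiag h σ) (not a) →
         Reaches𝔴 (corner (nextSide x (not a)) (suc i)) rest → Reaches𝔴 (corner σ i) (reducedBlock i h x ++ rest)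
    go true  .false upper    true  δi refl r = apex true δi r
    go true  .true  upper    false δi refl r = apex false δi r
    go false true   upper    true  δi c    r = reaches-∷ (diagAt i) (joins-diagAt i true i≤) (apex true δi r)
    go false false  upper    false δi c    r = reaches-∷ (diagAt i) (joins-diagAt i false i≤) (apex false δi r)
    go true  .true  lower    true  δi refl r = reaches-∷ (diagAt i) (joins-diagAt i true i≤) (apex true δi r)
    go true  .false lower    false δi refl r = reaches-∷ (diagAt i) (joins-diagAt i false i≤) (apex false δi r)
    go false false  lower    true  δi c    r = apex true δi r
    go false true   lower    false δi c    r = apex false δi r
    go true  .true  boundary true  δi refl r = reaches-∷ (bndAt i) (joins-bndAt′ i true i≤m δi) r
    go true  .false boundary false δi refl r = reaches-∷ (bndAt i) (joins-bndAt′ i false i≤m δi) r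
    go false false  boundary true  δi c    r =
      reaches-∷ (diagAt i) (joins-diagAt i false i≤) (reaches-∷ (bndAt i) (joins-bndAt′ i true i≤m δi) r)
    go false true   boundary false δi c    r =
      reaches-∷ (diagAt i) (joins-diagAt i true i≤) (reaches-∷ (bndAt i) (joins-bndAt′ i false i≤m δi) r)
    go false false  upper    true  δi () r
    go false true   upper    false δi () r
    go false true   lower    true  δi () r
    go false false  lower    false δi () r
    go false true   boundary true  δi () r
    go false false  boundary false δi () r

  reducedWord-reaches𝔴 : ∀ k i h σ xs wl → k + i ≡ suc m → Admissible k i h σ xs wl →
                         Reaches𝔴 (corner σ i) (reducedWord k i h xs wl)
  reducedWord-reaches𝔴 zero .(suc m) true σ [] .(wEdge σ) refl refl =
    reaches-∷ (wEdge σ) (joins-wEdge σ) reaches-[]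
  reducedWord-reaches𝔴 zero .(suc m) false σ [] .(wEdge (not σ)) refl refl =
    reaches-∷ (diagAt (suc m)) (joins-diagAt (suc m) σ ≤-refl) (reaches-∷ (wEdge (not σ)) (joins-wEdge (not σ)) reaches-[])
  reducedWord-reaches𝔴 (suc k) i h σ (x ∷ xs) wl eq (c , adm) =
    reducedBlock-reaches i h σ x (δAt i) (remaining⇒≤m k i eq) refl c
      (reducedWord-reaches𝔴 k (suc i) (isUpper x) _ xs wl (trans (+-suc k i) eq) adm)

  reducedWord-alternating : ∀ k i h xs wl → Alternating (not h) (reducedWord k i h xs wl)
  reducedWord-alternating zero    i true  []             wl = refl
  reducedWord-alternating zero    i false []             wl = (clamp i , refl) , refl
  reducedWord-alternating (suc k) i true  (lower ∷ xs)    wl = reducedWord-alternating k (suc i) false xs wl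
  reducedWord-alternating (suc k) i false (lower ∷ xs)    wl = reducedWord-alternating k (suc i) false xs wl
  reducedWord-alternating (suc k) i true  (upper ∷ xs)    wl = reducedWord-alternating k (suc i) true xs wl
  reducedWord-alternating (suc k) i false (upper ∷ xs)    wl = (clamp i , refl) , reducedWord-alternating k (suc i) true xs wl
  reducedWord-alternating (suc k) i true  (boundary ∷ xs) wl = reducedWord-alternating k (suc i) false xs wl
  reducedWord-alternating (suc k) i false (boundary ∷ xs) wl = (clamp i , refl) , reducedWord-alternating k (suc i) false xs wl

  _≺_ : Edge m → Edge m → Set
  e ≺ f = rank e < rank f

  ≺⇒≢ : ∀ {e f} → e ≺ f → e ≢ f
  ≺⇒≢ lt refl = <-irrefl refl lt

  RanksFrom : ℕ → List (Edge m) → Set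
  RanksFrom r = All (λ e → r ≤ rank e)

  RanksFrom-weaken : ∀ {r s es} → s ≤ r → RanksFrom r es → RanksFrom s es
  RanksFrom-weaken s≤r = All.map (≤-trans s≤r)

  RanksFrom⇒above : ∀ {r s es} → s < r → RanksFrom r es → All (λ e → s < rank e) es
  RanksFrom⇒above s<r = All.map (<-≤-trans s<r)

  odd-suc : ∀ i → _≡_ {A = ℕ} (suc (suc i + suc i)) (suc (suc (suc (i + i))))
  odd-suc i = cong (λ (z : ℕ) → suc (suc z)) (+-suc i i)

  odd<topRank : ∀ i → i ≤ suc m → suc (i + i) < topRank
  odd<topRank i i≤ = ≤-trans (s≤s (s≤s (double-≤ i≤))) (n≤1+n _)

  reducedBlock-sorted : ∀ i h x rest → i ≤ m → RanksFrom (suc (suc (suc (i + i)))) rest → AllPairs _≺_ rest →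
                        RanksFrom (suc (i + i)) (reducedBlock i h x ++ rest) × AllPairs _≺_ (reducedBlock i h x ++ rest)
  reducedBlock-sorted i h x rest i≤m r3 sorted = go h x
    where
    rD = rank-diagAt i (m≤n⇒m≤1+n i≤m)
    rB = rank-bndAt i i≤m
    D≺rest : All (diagAt i ≺_) rest
    D≺rest = subst (λ z → All (λ e → z < rank e) rest) (sym rD) (RanksFrom⇒above (s≤s (n≤1+n _)) r3)
    B≺rest : All (bndAt i ≺_) rest
    B≺rest = subst (λ z → All (λ e → z < rank e) rest) (sym rB) (RanksFrom⇒above ≤-refl r3)
    rest-above : RanksFrom (suc (i + i)) rest
    rest-above = RanksFrom-weaken (≤-trans (n≤1+n _) (n≤1+n _)) r3
    D-above : suc (i + i) ≤ rank (diagAt i)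
    D-above = ≤-reflexive (sym rD)
    B-above : suc (i + i) ≤ rank (bndAt i)
    B-above = subst (suc (i + i) ≤_) (sym rB) (n≤1+n _)
    D≺B : diagAt i ≺ bndAt i
    D≺B = subst₂ _<_ (sym rD) (sym rB) ≤-refl
    go : ∀ h x → RanksFrom (suc (i + i)) (reducedBlock i h x ++ rest) × AllPairs _≺_ (reducedBlock i h x ++ rest)
    go true  lower    = (D-above ∷ rest-above) , (D≺rest ∷ sorted)
    go false lower    = rest-above , sorted
    go true  upper    = rest-above , sorted
    go false upper    = (D-above ∷ rest-above) , (D≺rest ∷ sorted)
    go true  boundary = (B-above ∷ rest-above) , (B≺rest ∷ sorted)
    go false boundary = (D-above ∷ B-above ∷ rest-above) , ((D≺B ∷ D≺rest) ∷ B≺rest ∷ sorted)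

  reducedWord-sorted : ∀ k i h xs wl → k + i ≡ suc m → rank wl ≡ topRank →
    RanksFrom (suc (i + i)) (reducedWord k i h xs wl) × AllPairs _≺_ (reducedWord k i h xs wl)
  reducedWord-sorted zero .(suc m) true [] wl refl rw =
    (subst (suc (suc m + suc m) ≤_) (sym rw) (<⇒≤ (odd<topRank (suc m) ≤-refl)) ∷ []) , ([] ∷ [])
  reducedWord-sorted zero .(suc m) false [] wl refl rw =
    (≤-reflexive (sym rD) ∷ subst (suc (suc m + suc m) ≤_) (sym rw) (<⇒≤ (odd<topRank (suc m) ≤-refl)) ∷ []) ,
    ((subst₂ _<_ (sym rD) (sym rw) (odd<topRank (suc m) ≤-refl) ∷ []) ∷ [] ∷ [])
    where rD = rank-diagAt (suc m) ≤-refl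
  reducedWord-sorted (suc k) i h (x ∷ xs) wl eq rw =
    reducedBlock-sorted i h x (reducedWord k (suc i) (isUpper x) xs wl) (remaining⇒≤m k i eq)
      (subst (λ z → RanksFrom z (reducedWord k (suc i) (isUpper x) xs wl)) (odd-suc i) (proj₁ rest)) (proj₂ rest)
    where rest = reducedWord-sorted k (suc i) (isUpper x) xs wl (trans (+-suc k i) eq) rw

  reducedWord-nonempty : ∀ k i h xs wl → Σ (Edge m) λ y → Σ (List (Edge m)) λ zs → reducedWord k i h xs wl ≡ y ∷ zs
  reducedWord-nonempty zero    i true  []       wl = _ , _ , refl
  reducedWord-nonempty zero    i false []       wl = _ , _ , refl
  reducedWord-nonempty (suc k) i h     (x ∷ xs) wl with reducedBlock i h x | reducedWord-nonempty k (suc i) (isUpper x) xs wl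
  ... | []     | r = r
  ... | y ∷ ys | _ = y , ys ++ _ , refl

  reducedWord-head : ∀ k i h xs wl → k + suc i ≡ suc m → rank wl ≡ topRank →
    Σ (Edge m) λ y → Σ (List (Edge m)) λ zs →
      (reducedWord k (suc i) h xs wl ≡ y ∷ zs) × (suc (suc (suc (i + i))) ≤ rank y)
  reducedWord-head k i h xs wl eq rw
    with reducedWord-nonempty k (suc i) h xs wl | proj₁ (reducedWord-sorted k (suc i) h xs wl eq rw)
  ... | y , zs , e | r rewrite e with r
  ...   | y-above ∷ _ = y , zs , refl , subst (_≤ rank y) (odd-suc i) y-above

  -- The edges rawWord has not cancelled grow in rank, so diagAt i can only cancel
  -- against an immediately following diagAt i.
  cancelPairs-diagAt-rawWord : ∀ k i xs wl → k + i ≡ suc m → rank wl ≡ topRank →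
    cancelPairs (rawWord k i xs wl) ≡ reducedWord k i false xs wl →
    cancelPairs (diagAt i ∷ rawWord k i xs wl) ≡ reducedWord k i true xs wl
  cancelPairs-diagAt-rawWord zero .(suc m) [] wl refl rw c =
    cancelPairs-cancel (diagAt (suc m)) (rawWord zero (suc m) [] wl) (wl ∷ []) c
  cancelPairs-diagAt-rawWord (suc k) i (lower ∷ xs) wl eq rw c
    with reducedWord-head k i false xs wl (trans (+-suc k i) eq) rw
  ... | y , zs , e , y-above =
    trans (cancelPairs-keep (diagAt i) (rawWord (suc k) i (lower ∷ xs) wl) y zs (trans c e)
             (≺⇒≢ (subst (_< rank y) (sym (rank-diagAt i (m≤n⇒m≤1+n (remaining⇒≤m k i eq))))
                                      (≤-trans (s≤s (n≤1+n _)) y-above))))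
          (cong (diagAt i ∷_) (sym e))
  cancelPairs-diagAt-rawWord (suc k) i (upper ∷ xs) wl eq rw c =
    cancelPairs-cancel (diagAt i) (rawWord (suc k) i (upper ∷ xs) wl) (reducedWord k (suc i) true xs wl) c
  cancelPairs-diagAt-rawWord (suc k) i (boundary ∷ xs) wl eq rw c =
    cancelPairs-cancel (diagAt i) (rawWord (suc k) i (boundary ∷ xs) wl) (bndAt i ∷ reducedWord k (suc i) false xs wl) c

  cancelPairs-rawWord : ∀ k i xs wl → k + i ≡ suc m → rank wl ≡ topRank →
    cancelPairs (rawWord k i xs wl) ≡ reducedWord k i false xs wl
  cancelPairs-rawWord zero .(suc m) [] wl refl rw =
    cancelPairs-keep (diagAt (suc m)) (wl ∷ []) wl [] refl
      (≺⇒≢ (subst₂ _<_ (sym (rank-diagAt (suc m) ≤-refl)) (sym rw) (odd<topRank (suc m) ≤-refl)))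
  cancelPairs-rawWord (suc k) i (x ∷ xs) wl eq rw = go x
    where
    i≤m = remaining⇒≤m k i eq
    eq' = trans (+-suc k i) eq
    rest = cancelPairs-rawWord k (suc i) xs wl eq' rw
    D≢ : ∀ {y} → suc (suc (suc (i + i))) ≤ rank y → diagAt i ≢ y
    D≢ {y} q = ≺⇒≢ (subst (_< rank y) (sym (rank-diagAt i (m≤n⇒m≤1+n i≤m))) (≤-trans (s≤s (n≤1+n _)) q))
    B≢ : ∀ {y} → suc (suc (suc (i + i))) ≤ rank y → bndAt i ≢ y
    B≢ {y} q = ≺⇒≢ (subst (_< rank y) (sym (rank-bndAt i i≤m)) q)
    go : ∀ x → cancelPairs (rawWord (suc k) i (x ∷ xs) wl) ≡ reducedWord (suc k) i false (x ∷ xs) wl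
    go lower with reducedWord-head k i false xs wl eq' rw
    ... | y , zs , e , q =
      trans (cancelPairs-cancel (diagAt i) (diagAt i ∷ rawWord k (suc i) xs wl) (y ∷ zs)
               (cancelPairs-keep (diagAt i) (rawWord k (suc i) xs wl) y zs (trans rest e) (D≢ q)))
            (sym e)
    go upper with reducedWord-head k i true xs wl eq' rw
    ... | y , zs , e , q =
      trans (cancelPairs-keep (diagAt i) (diagAt (suc i) ∷ rawWord k (suc i) xs wl) y zs
               (trans (cancelPairs-diagAt-rawWord k (suc i) xs wl eq' rw rest) e) (D≢ q))
            (cong (diagAt i ∷_) (sym e))
    go boundary with reducedWord-head k i false xs wl eq' rw
    ... | y , zs , e , q =
      trans (cancelPairs-keep (diagAt i) (bndAt i ∷ rawWord k (suc i) xs wl) (bndAt i) (y ∷ zs)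
               (cancelPairs-keep (bndAt i) (rawWord k (suc i) xs wl) y zs (trans rest e) (B≢ q))
               (λ ()))
            (cong (λ z → diagAt i ∷ bndAt i ∷ z) (sym e))

  -- ψ S is the walk along a reduced word

  choice : GCC δ → Fin (suc m) → Choice
  choice S i = choiceOf (δ i) ∣ S₁ S i ∣ ∣ S₂ S i ∣

  choiceAt : GCC δ → ℕ → Choice
  choiceAt S o = choice S (arrowAt o)

  choicesFrom : GCC δ → (k o : ℕ) → Vec Choice k
  choicesFrom S zero    o = []
  choicesFrom S (suc k) o = choiceAt S o ∷ choicesFrom S k (suc o)

  diagAt-inject₁ : ∀ (j : Fin (suc m)) → diagAt (toℕ j) ≡ diag (inject₁ j)
  diagAt-inject₁ j = cong diag (Fin.toℕ-injective
    (trans (toℕ-clamp (toℕ j) (m≤n⇒m≤1+n (Fin.toℕ≤pred[n] j))) (sym (Fin.toℕ-inject₁ j))))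

  diagAt-suc : ∀ (j : Fin (suc m)) → diagAt (suc (toℕ j)) ≡ diag (suc j)
  diagAt-suc j = cong diag (Fin.toℕ-injective (toℕ-clamp (suc (toℕ j)) (s≤s (Fin.toℕ≤pred[n] j))))

  αmid-middleEdge : ∀ (S : GCC δ) j → αmid S j ≡ middleEdge (toℕ j) (choice S j)
  αmid-middleEdge S j with isPair ∣ S₁ S j ∣ ∣ S₂ S j ∣ (d (δ j)) (1 ∸ d (δ j))
                         | isPair ∣ S₁ S j ∣ ∣ S₂ S j ∣ (1 ∸ d (δ j)) (d (δ j))
  ... | true  | _     = sym (diagAt-inject₁ j)
  ... | false | true  = sym (diagAt-suc j)
  ... | false | false = cong bnd (sym (clamp-toℕ j))

  concatMap-rawWord : ∀ (S : GCC δ) {A : Set} n o (f : Fin n → A) (g : A → List (Edge m)) wl →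
    (∀ j → g (f j) ≡ diagAt (toℕ j + o) ∷ middleEdge (toℕ j + o) (choiceAt S (toℕ j + o)) ∷ []) →
    concatMap g (tabulate f) ++ (diagAt (n + o) ∷ wl ∷ []) ≡ rawWord n o (choicesFrom S n o) wl
  concatMap-rawWord S zero    o f g wl hyp = refl
  concatMap-rawWord S (suc n) o f g wl hyp = begin
    (g (f zero) ++ concatMap g (tabulate (f ∘ suc))) ++ (diagAt (suc n + o) ∷ wl ∷ [])
      ≡⟨ cong₂ (λ b t → (b ++ concatMap g (tabulate (f ∘ suc))) ++ (diagAt t ∷ wl ∷ [])) (hyp zero) (sym (+-suc n o)) ⟩
    diagAt o ∷ middleEdge o (choiceAt S o) ∷ (concatMap g (tabulate (f ∘ suc)) ++ (diagAt (n + suc o) ∷ wl ∷ []))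
      ≡⟨ cong (λ z → diagAt o ∷ middleEdge o (choiceAt S o) ∷ z) (concatMap-rawWord S n (suc o) (f ∘ suc) g wl hyp′) ⟩
    rawWord (suc n) o (choicesFrom S (suc n) o) wl ∎
    where
    open ≡-Reasoning
    hyp′ : ∀ j → g (f (suc j)) ≡ diagAt (toℕ j + suc o) ∷ middleEdge (toℕ j + suc o) (choiceAt S (toℕ j + suc o)) ∷ []
    hyp′ j = trans (hyp (suc j)) (cong (λ t → diagAt t ∷ middleEdge t (choiceAt S t) ∷ []) (sym (+-suc (toℕ j) o)))

  α′-rawWord : ∀ (S : GCC δ) → α′ S ≡ α₁ S ∷ rawWord (suc m) 0 (choicesFrom S (suc m) 0) (αlast S)
  α′-rawWord S = cong (α₁ S ∷_) (trans (cong (concatMap block (allFin (suc m)) ++_) lastDiag≡)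
                                       (concatMap-rawWord S (suc m) 0 id block (αlast S) block≡))
    where
    block : Fin (suc m) → List (Edge m)
    block i = diag (inject₁ i) ∷ αmid S i ∷ []
    block≡ : ∀ j → block j ≡ diagAt (toℕ j + 0) ∷ middleEdge (toℕ j + 0) (choiceAt S (toℕ j + 0)) ∷ []
    block≡ j rewrite +-identityʳ (toℕ j) =
      cong₂ (λ a b → a ∷ b ∷ []) (sym (diagAt-inject₁ j))
            (trans (αmid-middleEdge S j) (cong (λ i → middleEdge (toℕ j) (choice S i)) (sym (clamp-toℕ j))))
    lastDiag≡ : diag (lastDiag m) ∷ αlast S ∷ [] ≡ diagAt (suc m + 0) ∷ αlast S ∷ []
    lastDiag≡ = cong (λ z → diag z ∷ αlast S ∷ []) (Fin.toℕ-injective (trans (Fin.toℕ-fromℕ (suc m))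
      (trans (sym (+-identityʳ (suc m))) (sym (toℕ-clamp (suc m + 0) (≤-reflexive (+-identityʳ (suc m))))))))

  arrowAt-m : arrowAt m ≡ fromℕ m
  arrowAt-m = Fin.toℕ-injective (trans (toℕ-clamp m ≤-refl) (sym (Fin.toℕ-fromℕ m)))

  αlast-wEdge : ∀ (S : GCC δ) → αlast S ≡ wEdge (sideAfterNextDiag (choiceAt S m) (not (δAt m)))
  αlast-wEdge S = trans (lastEdge-choice (δ (fromℕ m)) (S₁ S (fromℕ m)) (S₂ S (fromℕ m)) (not11 S (fromℕ m)))
                        (cong (λ i → wEdge (sideAfterNextDiag (choice S i) (not (δ i)))) (sym arrowAt-m))

  rank-αlast : ∀ (S : GCC δ) → rank (αlast S) ≡ topRank
  rank-αlast S = trans (cong rank (αlast-wEdge S)) (rank-wEdge _)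

  choices-admissible : ∀ (S : GCC δ) k o h σ → k + suc o ≡ suc m →
    sideAfterDiag h σ ≡ sideAfterNextDiag (choiceAt S o) (not (δAt o)) →
    Admissible k (suc o) h σ (choicesFrom S k (suc o)) (αlast S)
  choices-admissible S zero    o h σ eq side≡ rewrite suc-injective eq = trans (αlast-wEdge S) (cong wEdge (sym side≡))
  choices-admissible S (suc k) o h σ eq side≡ =
    subst (λ z → Compatible x z (not (δAt (suc o)))) (sym side≡) compatible ,
    choices-admissible S k (suc o) (isUpper x) (nextSide x (not (δAt (suc o)))) (trans (+-suc k (suc o)) eq)
      (sideAfterDiag-next x _)
    where
    x = choiceAt S (suc o)
    so≤m = remaining⇒≤m k (suc o) eq
    i j : Fin (suc m)
    i = arrowAt o
    j = arrowAt (suc o)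
    j≡suc-i : toℕ j ≡ suc (toℕ i)
    j≡suc-i = trans (toℕ-clamp (suc o) so≤m) (cong suc (sym (toℕ-clamp o (≤-trans (n≤1+n o) so≤m))))
    compatible : Compatible x (sideAfterNextDiag (choiceAt S o) (not (δAt o))) (not (δAt (suc o)))
    compatible = adj⇒compatible (δ i) (δ j) (not11 S i) (not11 S j) (adj S i j j≡suc-i)

  arrowAt-0 : arrowAt 0 ≡ zero
  arrowAt-0 = clamp-toℕ {m} zero

  gcc-admissible : ∀ (S : GCC δ) → Σ Bool λ σ →
    (α₁ S ≡ vEdge σ) × Admissible (suc m) 0 false σ (choicesFrom S (suc m) 0) (αlast S)
  gcc-admissible S with firstEdge-choice (δ zero) (S₁ S zero) (S₂ S zero) (not11 S zero)
  ... | σ , α₁≡ , compatible = σ , α₁≡ ,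
        subst (λ i → Compatible (choice S i) (not σ) (not (δ i))) (sym arrowAt-0) compatible ,
        choices-admissible S m 0 (isUpper x) (nextSide x (not (δAt 0))) (+-comm m 1) (sideAfterDiag-next x _)
    where x = choiceAt S 0

  rank-α₁ : ∀ (S : GCC δ) → rank (α₁ S) ≡ 0
  rank-α₁ S = trans (cong rank (proj₁ (proj₂ (gcc-admissible S)))) (rank-vEdge _)

  reducedα : GCC δ → List (Edge m)
  reducedα S = α₁ S ∷ reducedWord (suc m) 0 false (choicesFrom S (suc m) 0) (αlast S)

  cancelPairs-α′ : ∀ (S : GCC δ) → cancelPairs (α′ S) ≡ reducedα S
  cancelPairs-α′ S = begin
    cancelPairs (α′ S)
      ≡⟨ cong cancelPairs (α′-rawWord S) ⟩
    cancelPairs (α₁ S ∷ rawWord (suc m) 0 xs (αlast S))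
      ≡⟨ cancelPairs-keep (α₁ S) (rawWord (suc m) 0 xs (αlast S)) y zs (trans reduced e) α₁≢y ⟩
    α₁ S ∷ y ∷ zs
      ≡⟨ cong (α₁ S ∷_) (sym e) ⟩
    reducedα S ∎
    where
    open ≡-Reasoning
    xs = choicesFrom S (suc m) 0
    reduced = cancelPairs-rawWord (suc m) 0 xs (αlast S) (+-identityʳ (suc m)) (rank-αlast S)
    nonempty = reducedWord-nonempty (suc m) 0 false xs (αlast S)
    y = proj₁ nonempty
    zs = proj₁ (proj₂ nonempty)
    e = proj₂ (proj₂ nonempty)
    y-above : 1 ≤ rank y
    y-above = All.head (subst (RanksFrom 1) e
                (proj₁ (reducedWord-sorted (suc m) 0 false xs (αlast S) (+-identityʳ (suc m)) (rank-αlast S))))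
    α₁≢y : α₁ S ≢ y
    α₁≢y = ≺⇒≢ (subst (_< rank y) (sym (rank-α₁ S)) y-above)

  ψ-reducedα : ∀ (S : GCC δ) → ψ S ≡ walk δ 𝔳 (reducedα S)
  ψ-reducedα S = cong (walk δ 𝔳) (cancelPairs-α′ S)

  -- ψ S is a T-path

  Alternating-tail : ∀ {p e es} → Alternating p (e ∷ es) → Alternating (not p) es
  Alternating-tail {true}  a = proj₂ a
  Alternating-tail {false} a = a

  Alternating-length : ∀ p es → Alternating p es → isEven (length es) ≡ p
  Alternating-length p []       a = sym a
  Alternating-length p (e ∷ es) a =
    trans (cong not (Alternating-length (not p) es (Alternating-tail {p} a))) (not-involutive p)

  Alternating⇒crosses : ∀ p (ps : Path m) → Alternating p (map proj₁ ps) →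
                        ∀ k → isEven (toℕ k) ≡ p → Crosses (edgeAt ps k)
  Alternating⇒crosses true  (_ ∷ ps) a zero    _ = proj₁ a
  Alternating⇒crosses false (_ ∷ ps) a zero    ()
  Alternating⇒crosses p     (_ ∷ ps) a (suc k) e =
    Alternating⇒crosses (not p) ps (Alternating-tail {p} a) k (not≡⇒≡not e)

  crosses⇒Alternating : ∀ p (ps : Path m) → (∀ k → isEven (toℕ k) ≡ p → Crosses (edgeAt ps k)) →
                        isEven (length ps) ≡ p → Alternating p (map proj₁ ps)
  crosses⇒Alternating p     []       h e = sym e
  crosses⇒Alternating true  (_ ∷ ps) h e =
    h zero refl , crosses⇒Alternating false ps (λ k ek → h (suc k) (cong not ek)) (not≡⇒≡not e)
  crosses⇒Alternating false (_ ∷ ps) h e =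
    crosses⇒Alternating true ps (λ k ek → h (suc k) (cong not ek)) (not≡⇒≡not e)

  map-proj₁-walk : ∀ u es → map proj₁ (walk δ u es) ≡ es
  map-proj₁-walk u []       = refl
  map-proj₁-walk u (e ∷ es) = cong (e ∷_) (map-proj₁-walk (other δ e u) es)

  reducedα-reaches𝔴 : ∀ (S : GCC δ) → Reaches𝔴 𝔳 (reducedα S)
  reducedα-reaches𝔴 S with gcc-admissible S
  ... | σ , α₁≡ , admissible =
    reaches-∷ (α₁ S) (subst (λ e → Joins δ e 𝔳 (corner σ 0)) (sym α₁≡) (joins-vEdge σ))
      (reducedWord-reaches𝔴 (suc m) 0 false σ _ (αlast S) (+-identityʳ _) admissible)

  reducedα-sorted : ∀ (S : GCC δ) → AllPairs _≺_ (reducedα S)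
  reducedα-sorted S =
    subst (λ z → All (λ e → z < rank e) word) (sym (rank-α₁ S)) (RanksFrom⇒above ≤-refl (proj₁ sorted)) ∷ proj₂ sorted
    where
    word = reducedWord (suc m) 0 false (choicesFrom S (suc m) 0) (αlast S)
    sorted = reducedWord-sorted (suc m) 0 false (choicesFrom S (suc m) 0) (αlast S) (+-identityʳ _) (rank-αlast S)

  ψ-isTPath : ∀ (S : GCC δ) → IsTPath δ (ψ S)
  ψ-isTPath S rewrite ψ-reducedα S = record
    { chain        = Reaches𝔴.chain (reducedα-reaches𝔴 S)
    ; ends-at      = Reaches𝔴.ends-at (reducedα-reaches𝔴 S)
    ; distinct     = subst (AllPairs _≢_) (sym walk-edges) (AllPairs.map ≺⇒≢ (reducedα-sorted S))
    ; odd-len      = isOdd⇒Odd (length ps) (trans (sym (cong isEven (length-map proj₁ ps)))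
                                                   (Alternating-length false (map proj₁ ps) alternating))
    ; even-crosses = λ k ek → Alternating⇒crosses false ps alternating k (not≡⇒≡not (Even⇒isEven ek))
    ; ordered      = λ k k' lt j j' e e' → double-cancel-< (toℕ j) (toℕ j')
                       (subst₂ _<_ (cong rank e) (cong rank e') (AllPairs-map₁-lookup ps sorted k k' lt))
    }
    where
    ps = walk δ 𝔳 (reducedα S)
    walk-edges = map-proj₁-walk 𝔳 (reducedα S)
    alternating : Alternating false (map proj₁ ps)
    alternating = subst (Alternating false) (sym walk-edges)
                        (reducedWord-alternating (suc m) 0 false (choicesFrom S (suc m) 0) (αlast S))
    sorted : AllPairs _≺_ (map proj₁ ps)
    sorted = subst (AllPairs _≺_) (sym walk-edges) (reducedα-sorted S)

  -- The weight identity

  rawWord-weight : ∀ S wl k o f → wordWeight (ℤ.- + 1) (rawWord k o (choicesFrom S k o) wl) f ≡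
    sumFrom (suc k) o (λ i → (diagAt i ^[ ℤ.- + 1 ]) f) ℤ.+
    (sumFrom k o (λ i → (middleEdge i (choiceAt S i) ^[ + 1 ]) f) ℤ.+ (wl ^[ + 1 ]) f)
  rawWord-weight S wl zero o f =
    solve 2 (λ a e → a :+ (e :+ con (+ 0)) := (a :+ con (+ 0)) :+ (con (+ 0) :+ e)) refl
      ((diagAt o ^[ ℤ.- + 1 ]) f) ((wl ^[ + 1 ]) f)
    where open +-*-Solver
  rawWord-weight S wl (suc k) o f =
    trans (cong (λ z → D o ℤ.+ (M o ℤ.+ z)) (rawWord-weight S wl k (suc o) f))
          (+-interleave (D o) (M o) (sumFrom (suc k) (suc o) D) (sumFrom k (suc o) M) ((wl ^[ + 1 ]) f))
    where
    D M : ℕ → ℤ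
    D i = (diagAt i ^[ ℤ.- + 1 ]) f
    M i = (middleEdge i (choiceAt S i) ^[ + 1 ]) f

  yMid-middleEdge : ∀ (S : GCC δ) i f → yMid S i f ≡ (middleEdge (toℕ i) (choice S i) ^[ + 1 ]) f
  yMid-middleEdge S i f = trans (yMid-monomial (δ i) (S₁ S i) (S₂ S i) (not11 S i) (inject₁ i) (suc i) (bnd i) f)
                                (cong (λ z → (z ^[ + 1 ]) f) (αmid-middleEdge S i))

  y₀-α₁ : ∀ (S : GCC δ) f → y₀ S f ≡ (α₁ S ^[ + 1 ]) f
  y₀-α₁ S f with ⌊ ∣ S[1+δ] S zero ∣ ≟ (1 ∸ d (δ zero)) ⌋
  ... | true  = refl
  ... | false = refl

  yₙ-αlast : ∀ (S : GCC δ) f → yₙ S f ≡ (αlast S ^[ + 1 ]) f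
  yₙ-αlast S f with ⌊ ∣ S[2-δ] S (lastArrow m) ∣ ≟ d (δ (lastArrow m)) ⌋
  ... | true  = refl
  ... | false = refl

  -- Both sides equal the exponent of x_f in x(α'), as cancelling pairs preserves it.
  ψ-weight : ∀ (S : GCC δ) f → gccWeight S f ≡ x[ ψ S ] f
  ψ-weight S f = trans lhs (sym rhs)
    where
    diags = sumFrom (suc (suc m)) 0 (λ i → (diagAt i ^[ ℤ.- + 1 ]) f)
    middles = sumFrom (suc m) 0 (λ i → (middleEdge i (choiceAt S i) ^[ + 1 ]) f)
    first = (α₁ S ^[ + 1 ]) f
    last = (αlast S ^[ + 1 ]) f
    diags≡ : prodFin (suc (suc m)) (λ j → diag j ^[ ℤ.- + 1 ]) f ≡ diags
    diags≡ = prodFin-sumFrom (suc (suc m)) 0 (λ j → diag j ^[ ℤ.- + 1 ]) (λ i → (diagAt i ^[ ℤ.- + 1 ]) f) f diag≡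
      where
      diag≡ : ∀ j → (diag j ^[ ℤ.- + 1 ]) f ≡ (diagAt (toℕ j + 0) ^[ ℤ.- + 1 ]) f
      diag≡ j rewrite +-identityʳ (toℕ j) | clamp-toℕ j = refl
    middles≡ : prodFin (suc m) (yMid S) f ≡ middles
    middles≡ = prodFin-sumFrom (suc m) 0 (yMid S) (λ i → (middleEdge i (choiceAt S i) ^[ + 1 ]) f) f middle≡
      where
      middle≡ : ∀ j → yMid S j f ≡ (middleEdge (toℕ j + 0) (choiceAt S (toℕ j + 0)) ^[ + 1 ]) f
      middle≡ j rewrite +-identityʳ (toℕ j) | clamp-toℕ j = yMid-middleEdge S j f
    lhs : gccWeight S f ≡ diags ℤ.+ (first ℤ.+ (middles ℤ.+ last))
    lhs = cong₂ ℤ._+_ diags≡ (cong₂ ℤ._+_ (y₀-α₁ S f) (cong₂ ℤ._+_ middles≡ (yₙ-αlast S f)))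
    rhs : x[ ψ S ] f ≡ diags ℤ.+ (first ℤ.+ (middles ℤ.+ last))
    rhs = begin
      x[ ψ S ] f
        ≡⟨ pathWeightFrom-walk δ (+ 1) 𝔳 (cancelPairs (α′ S)) f ⟩
      wordWeight (+ 1) (cancelPairs (α′ S)) f
        ≡⟨ wordWeight-cancelPairs (+ 1) (α′ S) f ⟩
      wordWeight (+ 1) (α′ S) f
        ≡⟨ cong (λ z → wordWeight (+ 1) z f) (α′-rawWord S) ⟩
      first ℤ.+ wordWeight (ℤ.- + 1) (rawWord (suc m) 0 (choicesFrom S (suc m) 0) (αlast S)) f
        ≡⟨ cong (λ z → first ℤ.+ z) (rawWord-weight S (αlast S) (suc m) 0 f) ⟩
      first ℤ.+ (diags ℤ.+ (middles ℤ.+ last))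
        ≡⟨ solve 4 (λ a b c e → a :+ (b :+ (c :+ e)) := b :+ (a :+ (c :+ e))) refl first diags middles last ⟩
      diags ℤ.+ (first ℤ.+ (middles ℤ.+ last)) ∎
      where
      open ≡-Reasoning
      open +-*-Solver

  -- Injectivity

  below-RanksFrom : ∀ {r e es es'} → RanksFrom r es' → e ∷ es ≡ es' → rank e < r → ⊥
  below-RanksFrom (e-above ∷ _) refl e-below = <⇒≱ e-below e-above

  reducedBlock-injective : ∀ i h x y rest rest' → i ≤ m →
    RanksFrom (suc (suc (suc (i + i)))) rest → RanksFrom (suc (suc (suc (i + i)))) rest' →
    reducedBlock i h x ++ rest ≡ reducedBlock i h y ++ rest' → (x ≡ y) × (rest ≡ rest')
  reducedBlock-injective i h x y rest rest' i≤m r r' = go h x y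
    where
    D< : rank (diagAt i) < suc (suc (suc (i + i)))
    D< = subst (_< suc (suc (suc (i + i)))) (sym (rank-diagAt i (m≤n⇒m≤1+n i≤m))) (s≤s (n≤1+n _))
    B< : rank (bndAt i) < suc (suc (suc (i + i)))
    B< = subst (_< suc (suc (suc (i + i)))) (sym (rank-bndAt i i≤m)) ≤-refl
    go : ∀ h x y → reducedBlock i h x ++ rest ≡ reducedBlock i h y ++ rest' → (x ≡ y) × (rest ≡ rest')
    go true  lower    lower    e = refl , Listₚ.∷-injectiveʳ e
    go true  lower    upper    e = ⊥-elim (below-RanksFrom r' e D<)
    go true  lower    boundary ()
    go true  upper    lower    e = ⊥-elim (below-RanksFrom r (sym e) D<)
    go true  upper    upper    e = refl , e
    go true  upper    boundary e = ⊥-elim (below-RanksFrom r (sym e) B<)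
    go true  boundary lower    ()
    go true  boundary upper    e = ⊥-elim (below-RanksFrom r' e B<)
    go true  boundary boundary e = refl , Listₚ.∷-injectiveʳ e
    go false lower    lower    e = refl , e
    go false lower    upper    e = ⊥-elim (below-RanksFrom r (sym e) D<)
    go false lower    boundary e = ⊥-elim (below-RanksFrom r (sym e) D<)
    go false upper    lower    e = ⊥-elim (below-RanksFrom r' e D<)
    go false upper    upper    e = refl , Listₚ.∷-injectiveʳ e
    go false upper    boundary e = ⊥-elim (below-RanksFrom r (sym (Listₚ.∷-injectiveʳ e)) B<)
    go false boundary lower    e = ⊥-elim (below-RanksFrom r' e D<)
    go false boundary upper    e = ⊥-elim (below-RanksFrom r' (Listₚ.∷-injectiveʳ e) B<)
    go false boundary boundary e = refl , Listₚ.∷-injectiveʳ (Listₚ.∷-injectiveʳ e)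

  reducedWord-injective : ∀ k i h xs ys wl wl' → k + i ≡ suc m → rank wl ≡ topRank → rank wl' ≡ topRank →
    reducedWord k i h xs wl ≡ reducedWord k i h ys wl' → xs ≡ ys
  reducedWord-injective zero i h [] [] wl wl' eq rw rw' e = refl
  reducedWord-injective (suc k) i h (x ∷ xs) (y ∷ ys) wl wl' eq rw rw' e
    with reducedBlock-injective i h x y _ _ (remaining⇒≤m k i eq) (above xs wl rw) (above ys wl' rw') e
    where
    eq' = trans (+-suc k i) eq
    above : ∀ {x} zs wl → rank wl ≡ topRank → RanksFrom (suc (suc (suc (i + i)))) (reducedWord k (suc i) (isUpper x) zs wl)
    above {x} zs wl rw = subst (λ r → RanksFrom r (reducedWord k (suc i) (isUpper x) zs wl)) (odd-suc i)
                               (proj₁ (reducedWord-sorted k (suc i) (isUpper x) zs wl eq' rw))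
  ... | refl , e' = cong (x ∷_) (reducedWord-injective k (suc i) (isUpper x) xs ys wl wl' (trans (+-suc k i) eq) rw rw' e')

  choicesFrom-lookup : ∀ (S S' : GCC δ) k o → choicesFrom S k o ≡ choicesFrom S' k o →
                       ∀ j → j < k → choiceAt S (j + o) ≡ choiceAt S' (j + o)
  choicesFrom-lookup S S' (suc k) o e zero    _       = Vecₚ.∷-injectiveˡ e
  choicesFrom-lookup S S' (suc k) o e (suc j) (s≤s j<k) = begin
    choiceAt S (suc j + o)   ≡⟨ cong (choiceAt S) (sym (+-suc j o)) ⟩
    choiceAt S (j + suc o)   ≡⟨ choicesFrom-lookup S S' k (suc o) (Vecₚ.∷-injectiveʳ e) j j<k ⟩
    choiceAt S' (j + suc o)  ≡⟨ cong (choiceAt S') (+-suc j o) ⟩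
    choiceAt S' (suc j + o)  ∎
    where open ≡-Reasoning

  ψ-injective : ∀ (S S' : GCC δ) → ψ S ≡ ψ S' → S ≈G S'
  ψ-injective S S' e i = choiceOf-injective (δ i) (not11 S i) (not11 S' i) choice≡
    where
    words≡ : reducedα S ≡ reducedα S'
    words≡ = trans (sym (map-proj₁-walk 𝔳 (reducedα S)))
             (trans (cong (map proj₁) (trans (sym (ψ-reducedα S)) (trans e (ψ-reducedα S'))))
                    (map-proj₁-walk 𝔳 (reducedα S')))
    choices≡ : choicesFrom S (suc m) 0 ≡ choicesFrom S' (suc m) 0
    choices≡ = reducedWord-injective (suc m) 0 false _ _ (αlast S) (αlast S') (+-identityʳ _)
                 (rank-αlast S) (rank-αlast S') (Listₚ.∷-injectiveʳ words≡)
    choice≡ : choice S i ≡ choice S' i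
    choice≡ = begin
      choice S i                  ≡⟨ cong (choice S) (clamp-toℕ i) ⟨
      choiceAt S (toℕ i)          ≡⟨ subst (λ z → choiceAt S z ≡ choiceAt S' z) (+-identityʳ (toℕ i))
                                       (choicesFrom-lookup S S' (suc m) 0 choices≡ (toℕ i) (Fin.toℕ<n i)) ⟩
      choiceAt S' (toℕ i)         ≡⟨ cong (choice S') (clamp-toℕ i) ⟩
      choice S' i                 ∎
      where open ≡-Reasoning

  -- Every T-path visits its edges in increasing rank

  DiagOrdered : Edge m → Edge m → Set
  DiagOrdered e f = ∀ j j' → e ≡ diag j → f ≡ diag j' → toℕ j < toℕ j'

  DiagAbove : Fin (suc (suc m)) → Edge m → Set
  DiagAbove j₀ f = ∀ j' → f ≡ diag j' → toℕ j₀ < toℕ j'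

  -- How the walk arrived at u₀ along e₀: across M_{𝔳,𝔴}, from 𝔳, or right after
  -- crossing a diagonal j₀ below all diagonals still to come.
  History : Edge m → Vert → Path m → Set
  History e₀ u₀ ps = Crosses e₀ ⊎ (u₀ ≡ 𝔳) ⊎
    (Σ (Fin (suc (suc m))) λ j₀ → Σ Vert λ y → Joins δ (diag j₀) y u₀ × All (DiagAbove j₀) (map proj₁ ps))

  bndLow bndHigh : Fin (suc m) → Vert
  bndLow  i = side (δ i) (height (δ i) (toℕ i))
  bndHigh i = side (δ i) (suc (height (δ i) (toℕ i)))

  height-suc-bnd : ∀ (i : Fin (suc m)) → height (δ i) (suc (toℕ i)) ≡ suc (height (δ i) (toℕ i))
  height-suc-bnd i =
    trans (count<-suc δ (δ i) i) (trans (cong (λ z → height (δ i) (toℕ i) + z) (indicator-self (δ i))) (+-comm _ 1))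

  Incident-diag-height : ∀ {j σ c} → Incident (diag j) (side σ c) → height σ (toℕ j) ≡ c
  Incident-diag-height {σ = true}  (inj₁ refl) = refl
  Incident-diag-height {σ = true}  (inj₂ ())
  Incident-diag-height {σ = false} (inj₁ ())
  Incident-diag-height {σ = false} (inj₂ refl) = refl

  diag-above-avoids-bndLow : ∀ i j → toℕ i < toℕ j → ¬ Incident (diag j) (bndLow i)
  diag-above-avoids-bndLow i j i<j x = 1+n≰n (subst (_≤ height (δ i) (toℕ i)) (height-suc-bnd i)
    (subst (height (δ i) (suc (toℕ i)) ≤_) (Incident-diag-height {j} x) (count<-mono δ (δ i) i<j)))

  diag-below-avoids-bndHigh : ∀ i j → toℕ j ≤ toℕ i → ¬ Incident (diag j) (bndHigh i)
  diag-below-avoids-bndHigh i j j≤i x =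
    1+n≰n (subst (_≤ height (δ i) (toℕ i)) (Incident-diag-height {j} x) (count<-mono δ (δ i) j≤i))

  ¬Crosses-bnd : ∀ {i} → ¬ Crosses (bnd {m} i)
  ¬Crosses-bnd (_ , ())

  ¬Crosses-v : ∀ {e : Edge m} → (e ≡ v0) ⊎ (e ≡ v1) → ¬ Crosses e
  ¬Crosses-v (inj₁ refl) (_ , ())
  ¬Crosses-v (inj₂ refl) (_ , ())

  ¬Crosses-w : ∀ {e : Edge m} → (e ≡ w0) ⊎ (e ≡ w1) → ¬ Crosses e
  ¬Crosses-w (inj₁ refl) (_ , ())
  ¬Crosses-w (inj₂ refl) (_ , ())

  Crosses? : ∀ f → Crosses {m} f ⊎ ¬ Crosses f
  Crosses? (diag j) = inj₁ (j , refl)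
  Crosses? (bnd i)  = inj₂ ¬Crosses-bnd
  Crosses? v0       = inj₂ (¬Crosses-v (inj₁ refl))
  Crosses? v1       = inj₂ (¬Crosses-v (inj₂ refl))
  Crosses? w0       = inj₂ (¬Crosses-w (inj₁ refl))
  Crosses? w1       = inj₂ (¬Crosses-w (inj₂ refl))

  Alternating-crosses-one : ∀ {p e f es} → Alternating p (e ∷ f ∷ es) → Crosses e ⊎ Crosses f
  Alternating-crosses-one {true}  a = inj₁ (proj₁ a)
  Alternating-crosses-one {false} a = inj₂ (proj₁ a)

  Alternating-two-noncrossing : ∀ {p e f es} → Alternating p (e ∷ f ∷ es) → ¬ Crosses e → ¬ Crosses f → ⊥
  Alternating-two-noncrossing {p} {e} {f} {es} a ¬ce ¬cf with Alternating-crosses-one {p} {e} {f} {es} a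
  ... | inj₁ c = ¬ce c
  ... | inj₂ c = ¬cf c

  path-nonempty : ∀ {u} (ps : Path m) → endVert u ps ≡ 𝔴 → u ≢ 𝔴 →
                  Σ (Edge m) λ g → Σ Vert λ u' → Σ (Path m) λ ps' → ps ≡ (g , u') ∷ ps'
  path-nonempty []               e u≢𝔴 = ⊥-elim (u≢𝔴 e)
  path-nonempty ((g , u') ∷ ps') e u≢𝔴 = g , u' , ps' , refl

  diag-avoids-𝔳 : ∀ {j} → ¬ Incident (diag j) 𝔳
  diag-avoids-𝔳 {j} x with Incident-𝔳 {diag j} x
  ... | inj₁ ()
  ... | inj₂ ()

  diag-avoids-𝔴 : ∀ {j} → ¬ Incident (diag j) 𝔴
  diag-avoids-𝔴 {j} x with Incident-𝔴 {diag j} x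
  ... | inj₁ ()
  ... | inj₂ ()

  bnd-avoids-𝔳 : ∀ {i} → ¬ Incident (bnd i) 𝔳
  bnd-avoids-𝔳 {i} x with Incident-𝔳 {bnd i} x
  ... | inj₁ ()
  ... | inj₂ ()

  bnd-avoids-𝔴 : ∀ {i} → ¬ Incident (bnd i) 𝔴
  bnd-avoids-𝔴 {i} x with Incident-𝔴 {bnd i} x
  ... | inj₁ ()
  ... | inj₂ ()

  edgesOf : Path m → List (Edge m)
  edgesOf = map proj₁

  v-edge-ends : ∀ {f} → (f ≡ v0) ⊎ (f ≡ v1) → ends δ f ≡ (𝔳 , proj₂ (ends δ f))
  v-edge-ends (inj₁ refl) = refl
  v-edge-ends (inj₂ refl) = refl

  w-edge-ends : ∀ {e} → (e ≡ w0) ⊎ (e ≡ w1) → ends δ e ≡ (𝔴 , proj₂ (ends δ e))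
  w-edge-ends (inj₁ refl) = refl
  w-edge-ends (inj₂ refl) = refl

  -- A walk that comes back to 𝔳 must leave it along T_{1,0} or T_{1,1} again.
  no-return-to-𝔳 : ∀ p e f u u' (ps : Path m) → (f ≡ v0) ⊎ (f ≡ v1) → Joins δ f u u' → u ≢ 𝔳 →
                   ChainFrom δ u' ps → endVert u' ps ≡ 𝔴 → Alternating p (e ∷ f ∷ edgesOf ps) → ⊥
  no-return-to-𝔳 p e f u u' ps fv jf u≢𝔳 ch en a with Joins-ends {f} jf (v-edge-ends fv)
  ... | inj₁ (u≡𝔳 , _) = u≢𝔳 u≡𝔳
  ... | inj₂ (_ , u'≡𝔳) with path-nonempty {u'} ps en (λ e → subst (_≢ 𝔴) (sym u'≡𝔳) (λ ()) e)
  ...   | g , u'' , ps' , refl with ch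
  ...     | jg , _ = Alternating-two-noncrossing {not p} (Alternating-tail {p} a) (¬Crosses-v fv)
                       (¬Crosses-v (Incident-𝔳 {g} (subst (Incident g) u'≡𝔳 (Joins⇒Incident₁ {g} jg))))

  crosses-after-bnd : ∀ {q i g es} → Alternating q (bnd i ∷ g ∷ es) → Crosses g
  crosses-after-bnd {q} {i} {g} {es} a with Alternating-crosses-one {q} {bnd i} {g} {es} a
  ... | inj₁ c = ⊥-elim (¬Crosses-bnd {i} c)
  ... | inj₂ c = c

  step-after-diag : ∀ p j u₀ u f u' (ps : Path m) → Joins δ (diag j) u₀ u → Joins δ f u u' → ChainFrom δ u' ps →
    endVert u' ps ≡ 𝔴 → Alternating p (diag j ∷ f ∷ edgesOf ps) → AllPairs DiagOrdered (diag j ∷ f ∷ edgesOf ps) →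
    diag j ≺ f
  step-after-diag p j u₀ u (diag j') u' ps jd jf ch en a ((o ∷ _) ∷ _) =
    s≤s (+-mono-< (o j j' refl refl) (o j j' refl refl))
  step-after-diag p j u₀ u (bnd i) u' ps jd jf ch en a ((o ∷ o₂) ∷ _) with toℕ j ≤? toℕ i
  ... | yes j≤i = s≤s (s≤s (+-mono-≤ j≤i j≤i))
  ... | no j≰i with path-nonempty {u'} ps en (λ e → bnd-avoids-𝔴 {i} (subst (Incident (bnd i)) e (Joins⇒Incident₂ {bnd i} jf)))
  ...   | g , u'' , ps' , refl with ch | crosses-after-bnd {not p} {i} {g} (Alternating-tail {p} a)
  ...     | jg , _ | j'' , refl with o₂
  ...       | o₃ ∷ _ = ⊥-elim (both-ends (Joins-ends {bnd i} jf (ends-bnd i)))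
    where
    i<j : toℕ i < toℕ j
    i<j = ≰⇒> j≰i
    j<j'' : toℕ j < toℕ j''
    j<j'' = o₃ j j'' refl refl
    both-ends : (u ≡ bndLow i × u' ≡ bndHigh i) ⊎ (u ≡ bndHigh i × u' ≡ bndLow i) → ⊥
    both-ends (inj₁ (u≡ , _)) = diag-above-avoids-bndLow i j i<j (subst (Incident (diag j)) u≡ (Joins⇒Incident₂ {diag j} jd))
    both-ends (inj₂ (_ , u'≡)) =
      diag-above-avoids-bndLow i j'' (<-trans i<j j<j'') (subst (Incident (diag j'')) u'≡ (Joins⇒Incident₁ {diag j''} jg))
  step-after-diag p j u₀ u v0 u' ps jd jf ch en a _ = ⊥-elim (no-return-to-𝔳 p (diag j) v0 u u' ps (inj₁ refl) jf
    (λ e → diag-avoids-𝔳 {j} (subst (Incident (diag j)) e (Joins⇒Incident₂ {diag j} jd))) ch en a)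
  step-after-diag p j u₀ u v1 u' ps jd jf ch en a _ = ⊥-elim (no-return-to-𝔳 p (diag j) v1 u u' ps (inj₂ refl) jf
    (λ e → diag-avoids-𝔳 {j} (subst (Incident (diag j)) e (Joins⇒Incident₂ {diag j} jd))) ch en a)
  step-after-diag p j u₀ u w0 u' ps jd jf ch en a _ = rank-diag<topRank j
  step-after-diag p j u₀ u w1 u' ps jd jf ch en a _ = rank-diag<topRank j

  step-after-bnd : ∀ p i u₀ u f u' (ps : Path m) → Joins δ (bnd i) u₀ u → History (bnd i) u₀ ((f , u') ∷ ps) →
    Joins δ f u u' → Alternating p (bnd i ∷ f ∷ edgesOf ps) → bnd i ≺ f
  step-after-bnd p i u₀ u f u' ps jb hist jf a with Alternating-crosses-one {p} {bnd i} {f} {edgesOf ps} a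
  ... | inj₁ c = ⊥-elim (¬Crosses-bnd {i} c)
  ... | inj₂ (j , refl) with toℕ i <? toℕ j
  ...   | yes i<j = s≤s (subst (_≤ toℕ j + toℕ j) (cong suc (+-suc (toℕ i) (toℕ i))) (+-mono-≤ i<j i<j))
  ...   | no i≮j = ⊥-elim (go hist)
    where
    j≤i : toℕ j ≤ toℕ i
    j≤i = ≮⇒≥ i≮j
    go : History (bnd i) u₀ ((diag j , u') ∷ ps) → ⊥
    go (inj₁ c) = ¬Crosses-bnd {i} c
    go (inj₂ (inj₁ u₀≡𝔳)) = bnd-avoids-𝔳 {i} (subst (Incident (bnd i)) u₀≡𝔳 (Joins⇒Incident₁ {bnd i} jb))
    go (inj₂ (inj₂ (j₀ , y , jd₀ , (above ∷ _)))) with Joins-ends {bnd i} jb (ends-bnd i)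
    ... | inj₁ (_ , u≡) = diag-below-avoids-bndHigh i j j≤i (subst (Incident (diag j)) u≡ (Joins⇒Incident₁ {diag j} jf))
    ... | inj₂ (u₀≡ , _) = diag-below-avoids-bndHigh i j₀ (<⇒≤ (<-≤-trans (above j refl) j≤i))
                             (subst (Incident (diag j₀)) u₀≡ (Joins⇒Incident₂ {diag j₀} jd₀))

  rank-positive : ∀ f → ¬ ((f ≡ v0) ⊎ (f ≡ v1)) → 0 < rank f
  rank-positive (diag _) _ = s≤s z≤n
  rank-positive (bnd _)  _ = s≤s z≤n
  rank-positive v0 n = ⊥-elim (n (inj₁ refl))
  rank-positive v1 n = ⊥-elim (n (inj₂ refl))
  rank-positive w0 _ = s≤s z≤n
  rank-positive w1 _ = s≤s z≤n

  no-step-after-w : ∀ p e₀ u₀ u f u' (ps : Path m) → (e₀ ≡ w0) ⊎ (e₀ ≡ w1) → Joins δ e₀ u₀ u →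
    History e₀ u₀ ((f , u') ∷ ps) → Joins δ f u u' → Alternating p (e₀ ∷ f ∷ edgesOf ps) → ⊥
  no-step-after-w p e₀ u₀ u f u' ps ew je hist jf a with Joins-ends {e₀} je (w-edge-ends ew)
  ... | inj₂ (_ , u≡𝔴) = Alternating-two-noncrossing {p} a (¬Crosses-w ew)
                           (¬Crosses-w (Incident-𝔴 {f} (subst (Incident f) u≡𝔴 (Joins⇒Incident₁ {f} jf))))
  ... | inj₁ (u₀≡𝔴 , _) = go hist
    where
    go : History e₀ u₀ ((f , u') ∷ ps) → ⊥
    go (inj₁ c) = ¬Crosses-w ew c
    go (inj₂ (inj₁ u₀≡𝔳)) with trans (sym u₀≡𝔴) u₀≡𝔳
    ... | ()
    go (inj₂ (inj₂ (j₀ , y , jd₀ , _))) = diag-avoids-𝔴 {j₀} (subst (Incident (diag j₀)) u₀≡𝔴 (Joins⇒Incident₂ {diag j₀} jd₀))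

  step-≺ : ∀ p e₀ u₀ u f u' (ps : Path m) → Joins δ e₀ u₀ u → History e₀ u₀ ((f , u') ∷ ps) → Joins δ f u u' →
    ChainFrom δ u' ps → endVert u' ps ≡ 𝔴 → Alternating p (e₀ ∷ f ∷ edgesOf ps) →
    AllPairs DiagOrdered (e₀ ∷ f ∷ edgesOf ps) → e₀ ≺ f
  step-≺ p (diag j) u₀ u f u' ps je hist jf ch en a o = step-after-diag p j u₀ u f u' ps je jf ch en a o
  step-≺ p (bnd i)  u₀ u f u' ps je hist jf ch en a o = step-after-bnd p i u₀ u f u' ps je hist jf a
  step-≺ p w0 u₀ u f u' ps je hist jf ch en a o = ⊥-elim (no-step-after-w p w0 u₀ u f u' ps (inj₁ refl) je hist jf a)
  step-≺ p w1 u₀ u f u' ps je hist jf ch en a o = ⊥-elim (no-step-after-w p w1 u₀ u f u' ps (inj₂ refl) je hist jf a)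
  step-≺ p v0 u₀ u f u' ps je hist jf ch en a o =
    rank-positive f (λ fv → Alternating-two-noncrossing {p} a (¬Crosses-v (inj₁ refl)) (¬Crosses-v fv))
  step-≺ p v1 u₀ u f u' ps je hist jf ch en a o =
    rank-positive f (λ fv → Alternating-two-noncrossing {p} a (¬Crosses-v (inj₂ refl)) (¬Crosses-v fv))

  tpath-linked : ∀ p e₀ u₀ u (ps : Path m) → Joins δ e₀ u₀ u → History e₀ u₀ ps → ChainFrom δ u ps →
    endVert u ps ≡ 𝔴 → Alternating p (e₀ ∷ edgesOf ps) → AllPairs DiagOrdered (e₀ ∷ edgesOf ps) →
    Linked _≺_ (e₀ ∷ edgesOf ps)
  tpath-linked p e₀ u₀ u [] je hist ch en a o = [-]
  tpath-linked p e₀ u₀ u ((f , u') ∷ ps) je hist (jf , ch) en a o@((_ ∷ above) ∷ o') =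
    step-≺ p e₀ u₀ u f u' ps je hist jf ch en a o ∷
    tpath-linked (not p) f u u' ps jf hist' ch en (Alternating-tail {p} a) o'
    where
    hist' : History f u ps
    hist' with Crosses? f
    ... | inj₁ c = inj₁ c
    ... | inj₂ ¬c with Alternating-crosses-one {p} {e₀} {f} {edgesOf ps} a
    ...   | inj₂ c = ⊥-elim (¬c c)
    ...   | inj₁ (j₀ , refl) = inj₂ (inj₂ (j₀ , u₀ , je , All.map (λ diagOrd j' eg → diagOrd j₀ j' refl eg) above))

  walk-∷ : ∀ e {u u' β es} → Joins δ e u u' → β ≡ walk δ u' es → (e , u') ∷ β ≡ walk δ u (e ∷ es)
  walk-∷ e {u} {u'} j eq = trans (cong ((e , u') ∷_) eq) (sym (walk-Joins e j))

  RanksFrom-∷ : ∀ {r e es} → AllPairs _≺_ (e ∷ es) → r ≤ rank e → RanksFrom r (e ∷ es)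
  RanksFrom-∷ (above ∷ _) r≤ = r≤ ∷ All.map (λ q → ≤-trans r≤ (<⇒≤ q)) above

  crossing-below-top : ∀ {e} → Crosses e → suc (suc (suc (suc (m + m)))) ≤ rank e → ⊥
  crossing-below-top c le = 1+n≰n (≤-trans le (rank-crossing-≤ c))

  above-last-diag : ∀ {g} → diagAt (suc m) ≺ g → suc (suc (suc (suc (m + m)))) ≤ rank g
  above-last-diag {g} lt = subst (_≤ rank g)
    (trans (cong suc (rank-diagAt (suc m) ≤-refl)) (cong (λ z → suc (suc (suc z))) (+-suc m m))) lt

  above-odd-suc-m : ∀ {x} → suc (suc (suc m + suc m)) ≤ x → suc (suc (suc (suc (m + m)))) ≤ x
  above-odd-suc-m {x} = subst (_≤ x) (cong (λ z → suc (suc (suc z))) (+-suc m m))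

  -- A tail of a T-path, standing at corner σ i with all edges above T_i; h as in
  -- reducedWord.
  Tail : ℕ → Bool → Bool → Path m → Set
  Tail i h σ β = ChainFrom δ (corner σ i) β × (endVert (corner σ i) β ≡ 𝔴) × Alternating (not h) (edgesOf β) ×
                 AllPairs _≺_ (edgesOf β) × RanksFrom (suc (i + i)) (edgesOf β)

  Parse : ℕ → ℕ → Bool → Bool → Path m → Set
  Parse k i h σ β = Σ (Vec Choice k) λ xs → Σ (Edge m) λ wl →
                    Admissible k i h σ xs wl × (β ≡ walk δ (corner σ i) (reducedWord k i h xs wl))

  parse-top : ∀ h σ β → Tail (suc m) h σ β → Parse zero (suc m) h σ β
  parse-top h σ [] (ch , en , _) = ⊥-elim (side≢𝔴 en)
  parse-top true σ ((e , u') ∷ β') (ch , en , a , sorted , (r ∷ _)) with m≤n⇒m<n∨m≡n r | ch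
  ... | inj₂ eq | (je , ch') with rank-odd⇒diagAt e (suc m) ≤-refl (sym eq)
  ...   | refl with path-nonempty {u'} β' en (subst (_≢ 𝔴) (sym (diagAt-other (suc m) σ ≤-refl je)) side≢𝔴)
  ...     | g , u'' , β'' , refl = ⊥-elim (crossing-below-top (proj₁ a) (above-last-diag {g} (All.head (AllPairs.head sorted))))
  parse-top true σ ((e , u') ∷ β') (ch , en , a , sorted , (r ∷ _)) | inj₁ lt | (je , ch')
    with wEdge-from-top σ je (rank-top⇒w e (above-odd-suc-m lt))
  ... | refl , refl with β'
  ...   | [] = [] , wEdge σ , refl , walk-∷ (wEdge σ) je refl
  ...   | (g , _) ∷ _ = ⊥-elim (crossing-below-top (proj₁ a)
          (≤-trans (≤-trans (n≤1+n _) (n≤1+n _)) (subst (_< rank g) (rank-wEdge σ) (All.head (AllPairs.head sorted)))))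
  parse-top false σ ((e , u') ∷ β') ((je , ch') , en , (c , a) , sorted , (r ∷ _)) with m≤n⇒m<n∨m≡n r
  ... | inj₁ lt = ⊥-elim (crossing-below-top c (above-odd-suc-m lt))
  ... | inj₂ eq with rank-odd⇒diagAt e (suc m) ≤-refl (sym eq)
  ...   | refl with path-nonempty {u'} β' en (subst (_≢ 𝔴) (sym (diagAt-other (suc m) σ ≤-refl je)) side≢𝔴)
  ...     | g , u'' , β'' , refl with ch'
  ...       | (jg , ch'') with wEdge-from-top (not σ) (subst (λ z → Joins δ g z u'') (diagAt-other (suc m) σ ≤-refl je) jg)
                                                   (rank-top⇒w g (above-last-diag {g} (All.head (AllPairs.head sorted))))
  ...         | refl , refl with β''
  ...           | [] = [] , wEdge (not σ) , refl , walk-∷ (diagAt (suc m)) je (walk-∷ (wEdge (not σ)) jg refl)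
  ...           | (g' , _) ∷ _ = ⊥-elim (crossing-below-top (proj₁ a)
                    (≤-trans (≤-trans (n≤1+n _) (n≤1+n _))
                             (subst (_< rank g') (rank-wEdge (not σ)) (All.head (AllPairs.head (AllPairs.tail sorted))))))

  module ParseBlock (k i : ℕ) (k+i≡ : suc k + i ≡ suc m)
                    (parse-rest : ∀ h σ β → Tail (suc i) h σ β → Parse k (suc i) h σ β) where

    i≤m : i ≤ m
    i≤m = remaining⇒≤m k i k+i≡

    i≤ : i ≤ suc m
    i≤ = m≤n⇒m≤1+n i≤m

    tail-at : ∀ {u h σ β} → u ≡ corner σ (suc i) → ChainFrom δ u β → endVert u β ≡ 𝔴 →
              Alternating (not h) (edgesOf β) → AllPairs _≺_ (edgesOf β) →
              RanksFrom (suc (suc (suc (i + i)))) (edgesOf β) → Tail (suc i) h σ β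
    tail-at {β = β} refl ch en a sorted r = ch , en , a , sorted , subst (λ z → RanksFrom z (edgesOf β)) (sym (odd-suc i)) r

    -- d is δ_i, made a variable so that it can be matched on.
    Parsed : Bool → Bool → Bool → Path m → Set
    Parsed d h σ β = Σ Choice λ x → Σ (Vec Choice k) λ xs → Σ (Edge m) λ wl →
      Compatible x (sideAfterDiag h σ) (not d) × Admissible k (suc i) (isUpper x) (nextSide x (not d)) xs wl ×
      (β ≡ walk δ (corner σ i) (reducedWord (suc k) i h (x ∷ xs) wl))

    module _ (d : Bool) (δi≡d : δAt i ≡ d) where

      apex≡ : corner (not d) (suc i) ≡ corner (not d) i
      apex≡ = apex-stays i d i≤m δi≡d

      moving-edge : ∀ f → Incident f (corner d i) → suc (suc (i + i)) ≤ rank f → f ≡ bndAt i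
      moving-edge f x r = moving-corner-edge i f i≤m (subst (λ t → Incident f (corner t i)) (sym δi≡d) x) r

      bnd-avoids-apex : ¬ Incident (bndAt i) (corner (not d) i)
      bnd-avoids-apex x = bndAt-avoids-apex i i≤m (subst (λ t → Incident (bndAt i) (corner (not t) i)) (sym δi≡d) x)

      bnd-other : ∀ {u'} → Joins δ (bndAt i) (corner d i) u' → u' ≡ corner (not (not d)) (suc i)
      bnd-other {u'} j = trans (subst (λ t → u' ≡ corner t (suc i)) δi≡d
        (bndAt-other i i≤m (subst (λ t → Joins δ (bndAt i) (corner t i) u') (sym δi≡d) j)))
        (cong (λ t → corner t (suc i)) (sym (not-involutive d)))

      diag-other : ∀ σ {u'} → Joins δ (diagAt i) (corner σ i) u' → u' ≡ corner (not σ) i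
      diag-other σ = diagAt-other i σ i≤

      ranks-after-diag : ∀ {es} → AllPairs _≺_ (diagAt i ∷ es) → RanksFrom (suc (suc (i + i))) es
      ranks-after-diag {es} sorted = subst (λ z → RanksFrom (suc z) es) (rank-diagAt i i≤) (AllPairs.head sorted)

      ranks-after-bnd : ∀ {es} → AllPairs _≺_ (bndAt i ∷ es) → RanksFrom (suc (suc (suc (i + i)))) es
      ranks-after-bnd {es} sorted = subst (λ z → RanksFrom (suc z) es) (rank-bndAt i i≤m) (AllPairs.head sorted)

      diag-from-apex : ∀ {u₁} → Joins δ (diagAt i) (corner (not d) i) u₁ → u₁ ≡ corner d i
      diag-from-apex jd = trans (diag-other (not d) jd) (cong (λ t → corner t i) (not-involutive d))

      diag-bnd-from-apex : ∀ {u₁ u''} → Joins δ (diagAt i) (corner (not d) i) u₁ → Joins δ (bndAt i) u₁ u'' →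
                           u'' ≡ corner (not (not d)) (suc i)
      diag-bnd-from-apex {u'' = u''} jd jb = bnd-other (subst (λ z → Joins δ (bndAt i) z u'') (diag-from-apex jd) jb)

      -- At the apex, T_{i,i+1} is unavailable, so the edges are even above it.
      ranks-at-apex : ∀ β → ChainFrom δ (corner (not d) i) β → AllPairs _≺_ (edgesOf β) →
                      RanksFrom (suc (suc (i + i))) (edgesOf β) → RanksFrom (suc (suc (suc (i + i)))) (edgesOf β)
      ranks-at-apex [] ch sorted r = []
      ranks-at-apex ((g , u) ∷ β) (jg , _) sorted (r ∷ _) with m≤n⇒m<n∨m≡n r
      ... | inj₁ lt = RanksFrom-∷ sorted lt
      ... | inj₂ eq with rank-even⇒bndAt g i i≤m (sym eq)
      ...   | refl = ⊥-elim (bnd-avoids-apex (Joins⇒Incident₁ {bndAt i} jg))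

      -- Crossing T_i from the apex leads to the moving corner, where no crossing edge
      -- above T_i starts.
      no-crossing-after-diag : ∀ {u₁ g u''} → Joins δ (diagAt i) (corner (not d) i) u₁ →
                               Joins δ g u₁ u'' → Crosses g → diagAt i ≺ g → ⊥
      no-crossing-after-diag {u₁} {g} jd jg c lt
        with moving-edge g (subst (Incident g) (diag-from-apex jd) (Joins⇒Incident₁ {g} jg))
                           (subst (λ z → suc z ≤ rank g) (rank-diagAt i i≤) lt)
      ... | refl = ¬Crosses-bnd c

      ranks-cancelled-apex : ∀ β → ChainFrom δ (corner (not d) i) β → endVert (corner (not d) i) β ≡ 𝔴 →
        Alternating false (edgesOf β) → AllPairs _≺_ (edgesOf β) →
        RanksFrom (suc (i + i)) (edgesOf β) → RanksFrom (suc (suc (suc (i + i)))) (edgesOf β)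
      ranks-cancelled-apex [] ch en a sorted r = []
      ranks-cancelled-apex ((e₁ , u₁) ∷ β') (je , ch') en a sorted (r ∷ _) with m≤n⇒m<n∨m≡n r
      ... | inj₂ eq with rank-odd⇒diagAt e₁ i i≤ (sym eq)
      ...   | refl with path-nonempty {u₁} β' en (subst (_≢ 𝔴) (sym (diag-other (not d) je)) side≢𝔴)
      ...     | g , u'' , β'' , refl with ch'
      ...       | (jg , _) = ⊥-elim (no-crossing-after-diag je jg (proj₁ a) (All.head (AllPairs.head sorted)))
      ranks-cancelled-apex ((e₁ , u₁) ∷ β') (je , ch') en a sorted (r ∷ _) | inj₁ lt with m≤n⇒m<n∨m≡n lt
      ... | inj₁ lt₂ = RanksFrom-∷ sorted lt₂
      ... | inj₂ eq with rank-even⇒bndAt e₁ i i≤m (sym eq)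
      ...   | refl = ⊥-elim (bnd-avoids-apex (Joins⇒Incident₁ {bndAt i} je))

      cancelled-apex : ∀ β → Tail i true (not d) β → Parsed d true (not d) β
      cancelled-apex β (ch , en , a , sorted , r)
        with parse-rest true (not d) β (tail-at (sym apex≡) ch en a sorted (ranks-cancelled-apex β ch en a sorted r))
      ... | xs , wl , adm , β≡ = upper , xs , wl , refl , adm , subst (λ z → β ≡ walk δ z _) apex≡ β≡

      cancelled-moving : ∀ β → Tail i true d β → Parsed d true d β
      cancelled-moving [] (ch , en , _) = ⊥-elim (side≢𝔴 en)
      cancelled-moving ((e₁ , u₁) ∷ β') ((je , ch') , en , a , sorted , (r ∷ _)) with m≤n⇒m<n∨m≡n r
      ... | inj₂ eq with rank-odd⇒diagAt e₁ i i≤ (sym eq)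
      ...   | refl with parse-rest false (not d) β'
                        (tail-at u₁≡ ch' en a (AllPairs.tail sorted)
                           (ranks-at-apex β' (subst (λ z → ChainFrom δ z β') (diag-other d je) ch') (AllPairs.tail sorted)
                                          (ranks-after-diag sorted)))
        where
        u₁≡ = trans (diag-other d je) (sym apex≡)
      ...     | xs , wl , adm , β'≡ = lower , xs , wl , sym (not-involutive d) , adm ,
                  walk-∷ (diagAt i) je (subst (λ z → β' ≡ walk δ z _) (sym (trans (diag-other d je) (sym apex≡))) β'≡)
      cancelled-moving ((e₁ , u₁) ∷ β') ((je , ch') , en , a , sorted , (r ∷ _)) | inj₁ lt
        with moving-edge e₁ (Joins⇒Incident₁ {e₁} je) lt
      ... | refl with parse-rest false (not (not d)) β'
                        (tail-at (bnd-other je) ch' en a (AllPairs.tail sorted)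
                           (ranks-after-bnd sorted))
      ...   | xs , wl , adm , β'≡ = boundary , xs , wl , sym (not-involutive d) , adm ,
                walk-∷ (bndAt i) je (subst (λ z → β' ≡ walk δ z _) (sym (bnd-other je)) β'≡)

      pending-moving : ∀ β → Tail i false d β → Parsed d false d β
      pending-moving [] (ch , en , _) = ⊥-elim (side≢𝔴 en)
      pending-moving ((e₁ , u₁) ∷ β') ((je , ch') , en , (c , a) , sorted , (r ∷ _)) with m≤n⇒m<n∨m≡n r
      ... | inj₁ lt with moving-edge e₁ (Joins⇒Incident₁ {e₁} je) lt
      ...   | refl = ⊥-elim (¬Crosses-bnd c)
      pending-moving ((e₁ , u₁) ∷ β') ((je , ch') , en , (c , a) , sorted , (r ∷ _)) | inj₂ eq
        with rank-odd⇒diagAt e₁ i i≤ (sym eq)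
      ... | refl with parse-rest true (not d) β'
                        (tail-at u₁≡ ch' en a (AllPairs.tail sorted)
                           (ranks-at-apex β' (subst (λ z → ChainFrom δ z β') (diag-other d je) ch') (AllPairs.tail sorted)
                                          (ranks-after-diag sorted)))
        where
        u₁≡ = trans (diag-other d je) (sym apex≡)
      ...   | xs , wl , adm , β'≡ = upper , xs , wl , refl , adm ,
                walk-∷ (diagAt i) je (subst (λ z → β' ≡ walk δ z _) (sym (trans (diag-other d je) (sym apex≡))) β'≡)

      pending-apex-lower : ∀ e₁ u₁ β' → e₁ ≢ diagAt i → Tail i false (not d) ((e₁ , u₁) ∷ β') →
                           Parsed d false (not d) ((e₁ , u₁) ∷ β')
      pending-apex-lower e₁ u₁ β' e₁≢D (ch , en , a@(c , _) , sorted , (r ∷ _))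
        with parse-rest false (not d) ((e₁ , u₁) ∷ β') (tail-at {h = false} (sym apex≡) ch en a sorted ranks)
        where
        ranks : RanksFrom (suc (suc (suc (i + i)))) (e₁ ∷ edgesOf β')
        ranks with m≤n⇒m<n∨m≡n r
        ... | inj₂ eq = ⊥-elim (e₁≢D (rank-odd⇒diagAt e₁ i i≤ (sym eq)))
        ... | inj₁ lt with m≤n⇒m<n∨m≡n lt
        ...   | inj₁ lt₂ = RanksFrom-∷ sorted lt₂
        ...   | inj₂ eq with rank-even⇒bndAt e₁ i i≤m (sym eq)
        ...     | refl = ⊥-elim (¬Crosses-bnd c)
      ... | xs , wl , adm , β≡ = lower , xs , wl , refl , adm , subst (λ z → _ ≡ walk δ z _) apex≡ β≡

      pending-apex-boundary : ∀ u₁ β' → Tail i false (not d) ((diagAt i , u₁) ∷ β') →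
                              Parsed d false (not d) ((diagAt i , u₁) ∷ β')
      pending-apex-boundary u₁ β' ((je , ch') , en , (_ , a) , sorted , _)
        with path-nonempty {u₁} β' en (subst (_≢ 𝔴) (sym (diag-other (not d) je)) side≢𝔴)
      ... | g , u'' , β'' , refl with ch'
      ...   | (jg , ch'') with moving-edge g (subst (Incident g) (diag-from-apex je) (Joins⇒Incident₁ {g} jg))
                                             (All.head (ranks-after-diag sorted))
      ...     | refl with parse-rest false (not (not d)) β''
                          (tail-at (diag-bnd-from-apex je jg) ch'' en a (AllPairs.tail (AllPairs.tail sorted))
                                   (ranks-after-bnd (AllPairs.tail sorted)))
      ...       | xs , wl , adm , β''≡ = boundary , xs , wl , refl , adm ,
                    walk-∷ (diagAt i) je (walk-∷ (bndAt i) jg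
                      (subst (λ z → β'' ≡ walk δ z _) (sym (diag-bnd-from-apex je jg)) β''≡))

      pending-apex : ∀ β → Tail i false (not d) β → Parsed d false (not d) β
      pending-apex [] (ch , en , _) = ⊥-elim (side≢𝔴 en)
      pending-apex ((e₁ , u₁) ∷ β') t with e₁ ≟E diagAt i
      ... | no e₁≢D  = pending-apex-lower e₁ u₁ β' e₁≢D t
      ... | yes refl = pending-apex-boundary u₁ β' t

    parsed : ∀ d (δi≡d : δAt i ≡ d) h σ β → Tail i h σ β → Parsed d h σ β
    parsed true  δi≡d true  true  = cancelled-moving true δi≡d
    parsed true  δi≡d true  false = cancelled-apex true δi≡d
    parsed true  δi≡d false true  = pending-moving true δi≡d
    parsed true  δi≡d false false = pending-apex true δi≡d
    parsed false δi≡d true  false = cancelled-moving false δi≡d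
    parsed false δi≡d true  true  = cancelled-apex false δi≡d
    parsed false δi≡d false false = pending-moving false δi≡d
    parsed false δi≡d false true  = pending-apex false δi≡d

    parse-block : ∀ h σ β → Tail i h σ β → Parse (suc k) i h σ β
    parse-block h σ β t with parsed (δAt i) refl h σ β t
    ... | x , xs , wl , c , adm , β≡ = x ∷ xs , wl , (c , adm) , β≡

  parse : ∀ k i h σ β → k + i ≡ suc m → Tail i h σ β → Parse k i h σ β
  parse zero    .(suc m) h σ β refl t = parse-top h σ β t
  parse (suc k) i        h σ β eq   t =
    ParseBlock.parse-block k i eq (λ h' σ' β' → parse k (suc i) h' σ' β' (trans (+-suc k i) eq)) h σ β t

  -- Surjectivity

  Admissible-adjacent : ∀ k o h σ xs wl → Admissible k o h σ xs wl → ∀ (q q' : Fin k) → toℕ q' ≡ suc (toℕ q) →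
    Compatible (Vec.lookup xs q') (sideAfterNextDiag (Vec.lookup xs q) (not (δAt (toℕ q + o)))) (not (δAt (toℕ q' + o)))
  Admissible-adjacent (suc (suc k)) o h σ (x ∷ x' ∷ xs) wl (_ , c' , _) zero (suc zero) _ =
    subst (λ z → Compatible x' z (not (δAt (suc o)))) (sideAfterDiag-next x _) c'
  Admissible-adjacent (suc k) o h σ (x ∷ xs) wl (_ , adm) (suc q) (suc q') eq =
    subst₂ (λ a b → Compatible (Vec.lookup xs q') (sideAfterNextDiag (Vec.lookup xs q) (not (δAt a))) (not (δAt b)))
           (+-suc (toℕ q) o) (+-suc (toℕ q') o)
           (Admissible-adjacent k (suc o) (isUpper x) (nextSide x (not (δAt o))) xs wl adm q q' (suc-injective eq))
  Admissible-adjacent (suc zero) o h σ (x ∷ []) wl _ zero (suc ()) _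
  Admissible-adjacent (suc (suc k)) o h σ (x ∷ x' ∷ xs) wl _ zero (suc (suc q')) ()

  Admissible-last : ∀ k o h σ x xs wl → Admissible (suc k) o h σ (x ∷ xs) wl →
    wl ≡ wEdge (sideAfterNextDiag (Vec.lookup (x ∷ xs) (fromℕ k)) (not (δAt (k + o))))
  Admissible-last zero    o h σ x []         wl (_ , adm) = trans adm (cong wEdge (sideAfterDiag-next x _))
  Admissible-last (suc k) o h σ x (x' ∷ xs) wl (_ , adm) =
    trans (Admissible-last k (suc o) (isUpper x) (nextSide x (not (δAt o))) x' xs wl adm)
          (cong (λ z → wEdge (sideAfterNextDiag (Vec.lookup (x' ∷ xs) (fromℕ k)) (not (δAt z)))) (+-suc k o))

  δAt-toℕ : ∀ (i : Fin (suc m)) → δAt (toℕ i + 0) ≡ δ i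
  δAt-toℕ i = cong δ (trans (cong clamp (+-identityʳ (toℕ i))) (clamp-toℕ i))

  gccOf : ∀ (xs : Vec Choice (suc m)) wl h σ → Admissible (suc m) 0 h σ xs wl → GCC δ
  gccOf xs wl h σ adm = record
    { S₁    = λ j → S₁-of (δ j) (Vec.lookup xs j)
    ; S₂    = λ j → S₂-of (δ j) (Vec.lookup xs j)
    ; not11 = λ j → S-of-notBoth (δ j) (Vec.lookup xs j)
    ; adj   = λ i j eq → Equivalence.from (choice-adj⇔compatible (δ i) (δ j) (Vec.lookup xs i) (Vec.lookup xs j))
                           (subst₂ (λ a b → Compatible (Vec.lookup xs j) (sideAfterNextDiag (Vec.lookup xs i) (not a)) (not b))
                                   (δAt-toℕ i) (δAt-toℕ j) (Admissible-adjacent (suc m) 0 h σ xs wl adm i j eq))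
    }

  choice-gccOf : ∀ xs wl h σ adm j → choice (gccOf xs wl h σ adm) j ≡ Vec.lookup xs j
  choice-gccOf xs wl h σ adm j = choiceOf-S-of (δ j) (Vec.lookup xs j)

  choicesFrom-lookup⁻ : ∀ (S : GCC δ) k o (xs : Vec Choice k) → (∀ (q : Fin k) → choiceAt S (toℕ q + o) ≡ Vec.lookup xs q) →
                        choicesFrom S k o ≡ xs
  choicesFrom-lookup⁻ S zero    o []       h = refl
  choicesFrom-lookup⁻ S (suc k) o (x ∷ xs) h =
    cong₂ _∷_ (h zero) (choicesFrom-lookup⁻ S k (suc o) xs (λ q → trans (cong (choiceAt S) (+-suc (toℕ q) o)) (h (suc q))))

  gccOf-ψ : ∀ σ₀ (β : Path m) x (xs' : Vec Choice m) wl → (adm : Admissible (suc m) 0 false σ₀ (x ∷ xs') wl) →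
            β ≡ walk δ (corner σ₀ 0) (reducedWord (suc m) 0 false (x ∷ xs') wl) →
            ψ (gccOf (x ∷ xs') wl false σ₀ adm) ≡ (vEdge σ₀ , corner σ₀ 0) ∷ β
  gccOf-ψ σ₀ β x xs' wl adm β≡ = begin
    ψ S
      ≡⟨ ψ-reducedα S ⟩
    walk δ 𝔳 (α₁ S ∷ reducedWord (suc m) 0 false (choicesFrom S (suc m) 0) (αlast S))
      ≡⟨ cong (walk δ 𝔳) (cong₂ _∷_ α₁≡ (cong₂ (reducedWord (suc m) 0 false) choices≡ αlast≡)) ⟩
    walk δ 𝔳 (vEdge σ₀ ∷ reducedWord (suc m) 0 false xs wl)
      ≡⟨ walk-∷ (vEdge σ₀) (joins-vEdge σ₀) β≡ ⟨
    (vEdge σ₀ , corner σ₀ 0) ∷ β ∎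
    where
    open ≡-Reasoning
    xs = x ∷ xs'
    S = gccOf xs wl false σ₀ adm
    choices≡ : choicesFrom S (suc m) 0 ≡ xs
    choices≡ = choicesFrom-lookup⁻ S (suc m) 0 xs
      (λ q → trans (cong (choice S) (trans (cong clamp (+-identityʳ (toℕ q))) (clamp-toℕ q))) (choice-gccOf xs wl false σ₀ adm q))
    first = firstEdge-choice (δ zero) (S₁ S zero) (S₂ S zero) (not11 S zero)
    σ₀≡ : proj₁ first ≡ σ₀
    σ₀≡ = not-injective (Compatible-unique
      (subst (λ z → Compatible z (not (proj₁ first)) (not (δ zero))) (choice-gccOf xs wl false σ₀ adm zero) (proj₂ (proj₂ first)))
      (subst (λ z → Compatible x (not σ₀) (not (δ z))) arrowAt-0 (proj₁ adm)))
    α₁≡ : α₁ S ≡ vEdge σ₀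
    α₁≡ = trans (proj₁ (proj₂ first)) (cong vEdge σ₀≡)
    αlast≡ : αlast S ≡ wl
    αlast≡ = begin
      αlast S
        ≡⟨ αlast-wEdge S ⟩
      wEdge (sideAfterNextDiag (choiceAt S m) (not (δAt m)))
        ≡⟨ cong (λ z → wEdge (sideAfterNextDiag z (not (δAt m))))
                (trans (choice-gccOf xs wl false σ₀ adm (arrowAt m)) (cong (Vec.lookup xs) arrowAt-m)) ⟩
      wEdge (sideAfterNextDiag (Vec.lookup xs (fromℕ m)) (not (δAt m)))
        ≡⟨ cong (λ z → wEdge (sideAfterNextDiag (Vec.lookup xs (fromℕ m)) (not (δAt z)))) (+-identityʳ m) ⟨
      wEdge (sideAfterNextDiag (Vec.lookup xs (fromℕ m)) (not (δAt (m + 0))))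
        ≡⟨ Admissible-last m 0 false σ₀ x xs' wl adm ⟨
      wl ∎

  IsTPath⇒Alternating : ∀ {α} → IsTPath δ α → Alternating false (edgesOf α)
  IsTPath⇒Alternating {α} T = crosses⇒Alternating false α
    (λ k ek → IsTPath.even-crosses T k (isEven⇒Even (suc (toℕ k)) (cong not ek))) (Odd⇒isOdd (IsTPath.odd-len T))

  IsTPath⇒sorted : ∀ {e₁ u₁ β} → IsTPath δ ((e₁ , u₁) ∷ β) → AllPairs _≺_ (edgesOf ((e₁ , u₁) ∷ β))
  IsTPath⇒sorted {e₁} {u₁} {β} T = Linked⇒AllPairs <-trans
    (tpath-linked false e₁ 𝔳 u₁ β (proj₁ chain) (inj₂ (inj₁ refl)) (proj₂ chain) ends-at (IsTPath⇒Alternating T)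
                  (lookup-AllPairs-map₁ ((e₁ , u₁) ∷ β) ordered))
    where open IsTPath T

  tpath-from-corner : ∀ σ₀ β → IsTPath δ ((vEdge σ₀ , corner σ₀ 0) ∷ β) →
                      Σ (GCC δ) λ S → ψ S ≡ (vEdge σ₀ , corner σ₀ 0) ∷ β
  tpath-from-corner σ₀ β T
    with parse (suc m) 0 false σ₀ β (+-identityʳ _)
           (proj₂ chain , ends-at , IsTPath⇒Alternating T , AllPairs.tail sorted ,
            subst (λ z → RanksFrom (suc z) (edgesOf β)) (rank-vEdge σ₀) (AllPairs.head sorted))
    where
    open IsTPath T
    sorted = IsTPath⇒sorted T
  ... | x ∷ xs' , wl , adm , β≡ = gccOf (x ∷ xs') wl false σ₀ adm , gccOf-ψ σ₀ β x xs' wl adm β≡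

  ψ-surjective : ∀ (α : Path m) → IsTPath δ α → Σ (GCC δ) λ S → ψ S ≡ α
  ψ-surjective [] T with () ← IsTPath.ends-at T
  ψ-surjective ((e₁ , u₁) ∷ β) T with Incident-𝔳 {e₁} (Joins⇒Incident₁ {e₁} (proj₁ (IsTPath.chain T)))
  ... | inj₁ refl with refl ← Joins-other {v0} (proj₁ (IsTPath.chain T)) refl refl (λ ()) = tpath-from-corner false β T
  ... | inj₂ refl with refl ← Joins-other {v1} (proj₁ (IsTPath.chain T)) refl refl (λ ()) = tpath-from-corner true β T

theorem9p3 : (m : ℕ) (δ : Fin (suc m) → Bool) →
    ((S : GCC δ) → IsTPath δ (ψ S))
    × ((S S' : GCC δ) → ψ S ≡ ψ S' → S ≈G S')
    × ((α : Path m) → IsTPath δ α → Σ (GCC δ) (λ S → ψ S ≡ α))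
    × ((S : GCC δ) → (f : Edge m) → gccWeight S f ≡ x[ ψ S ] f)
theorem9p3 m δ = ψ-isTPath m δ , ψ-injective m δ , ψ-surjective m δ , ψ-weight m δ
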